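{- Let $N$ be a positive integer. There exists an antipodal $5$-design with $2N$ rational points for the Chebyshev measure $(1-t^2)^{ -1/2}dt/\pi$ on $(-1,1)$ if and only if $N=3k$ with $k\ge1$, or $N=3k+1$ with $k\ge 6$, or $N=3k+2$ with $k\ge 3$.
   Context: An $m$-design with $n$ points for a probability measure $w(t)dt$ on an interval $I$ is a set of $n$ pairwise distinct points $x_1,\dots,x_n\in I$ with $\frac1n\sum_i f(x_i)=\int_I f(t)w(t)dt$ for every real polynomial $f$ of degree at most $m$. It is rational if all $x_i\in\mathbb{Q}$ and antipodal if $\{x_i\}=\{ -x_i\}$. The Chebyshev measure is $w(t)=\frac{1}{\pi\sqrt{1-t^2}}$ on $(-1,1)$. -}

module Defs where

open import Data.Nat as ℕ using (ℕ; zero; suc; _≤_)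
open import Data.Nat.Properties using (m^n≢0)
open import Data.Nat.Combinatorics using (_C_)
open import Data.Bool using (if_then_else_)
open import Data.Integer using (+_)
open import Data.Rational using (ℚ; 0ℚ; 1ℚ; _+_; _*_; -_; _<_; _/_)
open import Data.List using (List; foldr; map; length)
open import Data.List.Relation.Unary.All using (All)
open import Data.List.Relation.Unary.Unique.Propositional using (Unique)
open import Data.List.Membership.Propositional using (_∈_)
open import Data.Product using (_×_)
open import Relation.Binary.PropositionalEquality using (_≡_)

_^ℚ_ : ℚ → ℕ → ℚ
x ^ℚ zero  = 1ℚ
x ^ℚ suc k = x * (x ^ℚ k)

sumℚ : List ℚ → ℚ
sumℚ = foldr _+_ 0ℚ

ℕ→ℚ : ℕ → ℚ
ℕ→ℚ n = (+ n) / 1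

-- j-th moment ∫_{-1}^{1} t^j (1-t^2)^{-1/2} dt/π of the Chebyshev measure:
-- 0 for odd j, and binom(2m,m)/4^m for j = 2m.
evenChebMoment : ℕ → ℚ
evenChebMoment m = ((+ ((2 ℕ.* m) C m)) / (4 ℕ.^ m)) {{m^n≢0 4 m}}

chebMoment : ℕ → ℚ
chebMoment j = if (j ℕ.% 2) ℕ.≡ᵇ 0 then evenChebMoment (j ℕ./ 2) else 0ℚ

-- xs is an m-design for the Chebyshev measure (with n = length xs points):
-- pairwise distinct points of (-1,1) such that the average of every monomial
-- t^j, j ≤ m, equals its Chebyshev moment (equivalently, by linearity, the
-- average of every polynomial of degree ≤ m equals its integral).
-- The equation is multiplied through by n to avoid division.
IsChebyshevDesign : ℕ → List ℚ → Set
IsChebyshevDesign m xs =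
  Unique xs
  × All (λ x → (- 1ℚ < x) × (x < 1ℚ)) xs
  × (∀ j → j ≤ m → sumℚ (map (λ x → x ^ℚ j) xs) ≡ ℕ→ℚ (length xs) * chebMoment j)

Antipodal : List ℚ → Set
Antipodal xs = All (λ x → (- x) ∈ xs) xs

-- An antipodal design with 2N points is a set of N positive rationals together with their
-- negatives; its odd moments vanish, so it is a 5-design exactly when the N positive points y
-- satisfy Σ y² = N/2 and Σ y⁴ = 3N/8.
--
-- Clearing denominators gives naturals p and q > 0 with 2 Σ p² = N q² and
-- 8 Σ p⁴ = 3 N q⁴.  Odd squares are 1 mod 8 and odd fourth powers 1 mod 16, so: if q is odd
-- then 32 ∣ N; if q is even, either every p is even and (p, q) can be halved, or the number m
-- of odd p is ≡ 0 or 6N (mod 16), and m = N is impossible when N is 16 times an odd number.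
-- For N ∈ {1, 2, 4, 5, 7, 8, 10, 13, 16} no case survives, which gives a descent on q.
--
-- For every rational t the triple ½ − 3(t+1)/(t²+3), ½ + 3(t−1)/(t²+3),
-- 1 − 6/(t²+3) has square sum 3/2 and fourth-power sum 9/8.  The triples for t = 100, 101, …
-- are pairwise disjoint and lie in three narrow bands, so k of them give N = 3k, and explicit
-- sets of 11 and 19 points in the gaps between the bands give N = 3k + 2 (k ≥ 3) and
-- N = 3k + 1 (k ≥ 6).

module Submission where

module Rationals where

  open import Level using (0ℓ)
  open import Data.Maybe using (Maybe; just; nothing)
  open import Data.Nat as ℕ using (ℕ; zero; suc)
  open import Data.Integer as ℤ using (ℤ; +_)
  import Data.Integer.Properties as ℤP
  import Data.Nat.Properties as ℕP
  import Data.Integer.Tactic.RingSolver as ℤSolver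
  open import Data.Rational as ℚ using (ℚ; 0ℚ; 1ℚ; _+_; _*_; -_; _<_; _/_; toℚᵘ)
  import Data.Rational.Properties as ℚP
  open import Data.Rational.Unnormalised as ℚᵘ using (mkℚᵘ; *≡*; *<*)
  import Data.Rational.Unnormalised.Properties as ℚᵘP
  open import Relation.Nullary using (yes; no)
  open import Relation.Binary.PropositionalEquality
  open import Tactic.RingSolver.Core.AlmostCommutativeRing using (AlmostCommutativeRing; fromCommutativeRing)
  open import Tactic.RingSolver using (solve-∀)
  open import Defs using (ℕ→ℚ; _^ℚ_)

  ℚ-ring : AlmostCommutativeRing 0ℓ 0ℓ
  ℚ-ring = fromCommutativeRing ℚP.+-*-commutativeRing 0≟
    where
    0≟ : ∀ x → Maybe (0ℚ ≡ x)
    0≟ x with 0ℚ ℚP.≟ x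
    ... | yes 0≡x = just 0≡x
    ... | no _    = nothing

  fromℤ : ℤ → ℚ
  fromℤ z = z / 1

  toℚᵘ-/ : ∀ n d → toℚᵘ (n / suc d) ℚᵘ.≃ mkℚᵘ n d
  toℚᵘ-/ n d = ℚP.toℚᵘ-fromℚᵘ (mkℚᵘ n d)

  fromℤ-homo-+ : ∀ a b → fromℤ (a ℤ.+ b) ≡ fromℤ a + fromℤ b
  fromℤ-homo-+ a b = ℚP.toℚᵘ-injective (begin
    toℚᵘ (fromℤ (a ℤ.+ b))              ≈⟨ toℚᵘ-/ (a ℤ.+ b) 0 ⟩
    mkℚᵘ (a ℤ.+ b) 0                    ≈⟨ *≡* (sum-cross a b) ⟩
    mkℚᵘ a 0 ℚᵘ.+ mkℚᵘ b 0              ≈⟨ ℚᵘP.+-cong (toℚᵘ-/ a 0) (toℚᵘ-/ b 0) ⟨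
    toℚᵘ (fromℤ a) ℚᵘ.+ toℚᵘ (fromℤ b)  ≈⟨ ℚP.toℚᵘ-homo-+ (fromℤ a) (fromℤ b) ⟨
    toℚᵘ (fromℤ a + fromℤ b)            ∎)
    where
    open ℚᵘP.≃-Reasoning
    sum-cross : ∀ a b → (a ℤ.+ b) ℤ.* + 1 ≡ (a ℤ.* + 1 ℤ.+ b ℤ.* + 1) ℤ.* + 1
    sum-cross = ℤSolver.solve-∀

  fromℤ-homo-* : ∀ a b → fromℤ (a ℤ.* b) ≡ fromℤ a * fromℤ b
  fromℤ-homo-* a b = ℚP.toℚᵘ-injective (begin
    toℚᵘ (fromℤ (a ℤ.* b))              ≈⟨ toℚᵘ-/ (a ℤ.* b) 0 ⟩
    mkℚᵘ a 0 ℚᵘ.* mkℚᵘ b 0              ≈⟨ ℚᵘP.*-cong (toℚᵘ-/ a 0) (toℚᵘ-/ b 0) ⟨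
    toℚᵘ (fromℤ a) ℚᵘ.* toℚᵘ (fromℤ b)  ≈⟨ ℚP.toℚᵘ-homo-* (fromℤ a) (fromℤ b) ⟨
    toℚᵘ (fromℤ a * fromℤ b)            ∎)
    where open ℚᵘP.≃-Reasoning

  fromℤ-injective : ∀ {a b} → fromℤ a ≡ fromℤ b → a ≡ b
  fromℤ-injective {a} {b} eq = cancel (begin
    mkℚᵘ a 0         ≈⟨ toℚᵘ-/ a 0 ⟨
    toℚᵘ (fromℤ a)   ≈⟨ ℚP.toℚᵘ-cong eq ⟩
    toℚᵘ (fromℤ b)   ≈⟨ toℚᵘ-/ b 0 ⟩
    mkℚᵘ b 0         ∎)
    where
    open ℚᵘP.≃-Reasoning
    cancel : mkℚᵘ a 0 ℚᵘ.≃ mkℚᵘ b 0 → a ≡ b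
    cancel (*≡* a*1≡b*1) = trans (sym (ℤP.*-identityʳ a)) (trans a*1≡b*1 (ℤP.*-identityʳ b))

  ℕ→ℚ-homo-+ : ∀ m n → ℕ→ℚ (m ℕ.+ n) ≡ ℕ→ℚ m + ℕ→ℚ n
  ℕ→ℚ-homo-+ m n = trans (cong fromℤ (ℤP.pos-+ m n)) (fromℤ-homo-+ (+ m) (+ n))

  ℕ→ℚ-homo-* : ∀ m n → ℕ→ℚ (m ℕ.* n) ≡ ℕ→ℚ m * ℕ→ℚ n
  ℕ→ℚ-homo-* m n = trans (cong fromℤ (ℤP.pos-* m n)) (fromℤ-homo-* (+ m) (+ n))

  a/m<b/n : ∀ a d b e → a ℕ.* suc e ℕ.< b ℕ.* suc d → + a / suc d < + b / suc e
  a/m<b/n a d b e lt = ℚP.toℚᵘ-cancel-< (ℚᵘP.<-respˡ-≃ (ℚᵘP.≃-sym (toℚᵘ-/ (+ a) d))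
    (ℚᵘP.<-respʳ-≃ (ℚᵘP.≃-sym (toℚᵘ-/ (+ b) e))
      (*<* (subst₂ ℤ._<_ (ℤP.pos-* a (suc e)) (ℤP.pos-* b (suc d)) (ℤ.+<+ lt)))))

  0<a/n : ∀ a d → 0 ℕ.< a → 0ℚ < + a / suc d
  0<a/n a d 0<a = a/m<b/n 0 0 a d (subst (0 ℕ.<_) (sym (ℕP.*-identityʳ a)) 0<a)

  a/n≡a*1/n : ∀ a d → + a / suc d ≡ ℕ→ℚ a * (+ 1 / suc d)
  a/n≡a*1/n a d = ℚP.toℚᵘ-injective (begin
    toℚᵘ (+ a / suc d)                       ≈⟨ toℚᵘ-/ (+ a) d ⟩
    mkℚᵘ (+ a) d                             ≈⟨ *≡* (cross (+ a) (+ suc d)) ⟩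
    mkℚᵘ (+ a) 0 ℚᵘ.* mkℚᵘ (+ 1) d           ≈⟨ ℚᵘP.*-cong (toℚᵘ-/ (+ a) 0) (toℚᵘ-/ (+ 1) d) ⟨
    toℚᵘ (ℕ→ℚ a) ℚᵘ.* toℚᵘ (+ 1 / suc d)     ≈⟨ ℚP.toℚᵘ-homo-* (ℕ→ℚ a) (+ 1 / suc d) ⟨
    toℚᵘ (ℕ→ℚ a * (+ 1 / suc d))             ∎)
    where
    open ℚᵘP.≃-Reasoning
    cross : ∀ a D → a ℤ.* (+ 1 ℤ.* D) ≡ (a ℤ.* + 1) ℤ.* D
    cross = ℤSolver.solve-∀

  1/n*n≡1 : ∀ d → + 1 / suc d * ℕ→ℚ (suc d) ≡ 1ℚ
  1/n*n≡1 d = ℚP.toℚᵘ-injective (begin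
    toℚᵘ (+ 1 / suc d * ℕ→ℚ (suc d))          ≈⟨ ℚP.toℚᵘ-homo-* (+ 1 / suc d) (ℕ→ℚ (suc d)) ⟩
    toℚᵘ (+ 1 / suc d) ℚᵘ.* toℚᵘ (ℕ→ℚ (suc d)) ≈⟨ ℚᵘP.*-cong (toℚᵘ-/ (+ 1) d) (toℚᵘ-/ (+ suc d) 0) ⟩
    mkℚᵘ (+ 1) d ℚᵘ.* mkℚᵘ (+ suc d) 0        ≈⟨ *≡* cross ⟩
    toℚᵘ 1ℚ                                   ∎)
    where
    open ℚᵘP.≃-Reasoning
    regroup : ∀ D → (+ 1 ℤ.* D) ℤ.* + 1 ≡ + 1 ℤ.* D
    regroup = ℤSolver.solve-∀
    cross : (+ 1 ℤ.* + suc d) ℤ.* + 1 ≡ + 1 ℤ.* + (suc d ℕ.* 1)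
    cross = trans (regroup (+ suc d)) (cong (λ n → + 1 ℤ.* + n) (sym (ℕP.*-identityʳ (suc d))))

  ℕ→ℚ-injective : ∀ {m n} → ℕ→ℚ m ≡ ℕ→ℚ n → m ≡ n
  ℕ→ℚ-injective eq = ℤP.+-injective (fromℤ-injective eq)

  *-denominator : ∀ y → y * ℕ→ℚ (ℚ.denominatorℕ y) ≡ fromℤ (ℚ.numerator y)
  *-denominator y@(ℚ.mkℚ n d _) = ℚP.toℚᵘ-injective (begin
    toℚᵘ (y * ℕ→ℚ (suc d))                    ≈⟨ ℚP.toℚᵘ-homo-* y (ℕ→ℚ (suc d)) ⟩
    mkℚᵘ n d ℚᵘ.* toℚᵘ (ℕ→ℚ (suc d))          ≈⟨ ℚᵘP.*-congˡ {mkℚᵘ n d} (toℚᵘ-/ (+ suc d) 0) ⟩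
    mkℚᵘ n d ℚᵘ.* mkℚᵘ (+ suc d) 0            ≈⟨ *≡* cross ⟩
    mkℚᵘ n 0                                  ≈⟨ toℚᵘ-/ n 0 ⟨
    toℚᵘ (fromℤ n)                            ∎)
    where
    open ℚᵘP.≃-Reasoning
    regroup : ∀ n D → (n ℤ.* D) ℤ.* + 1 ≡ n ℤ.* D
    regroup = ℤSolver.solve-∀
    cross : (n ℤ.* + suc d) ℤ.* + 1 ≡ n ℤ.* + (suc d ℕ.* 1)
    cross = trans (regroup n (+ suc d)) (cong (λ k → n ℤ.* + k) (sym (ℕP.*-identityʳ (suc d))))

  neg-^-even : ∀ k x → (- x) ^ℚ (2 ℕ.* k) ≡ x ^ℚ (2 ℕ.* k)
  neg-^-even zero x = refl
  neg-^-even (suc k) x = subst (λ n → (- x) ^ℚ n ≡ x ^ℚ n) (sym (ℕP.*-suc 2 k))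
    (trans (cong (λ y → - x * (- x * y)) (neg-^-even k x)) (neg-neg-square x (x ^ℚ (2 ℕ.* k))))
    where
    neg-neg-square : ∀ x y → - x * (- x * y) ≡ x * (x * y)
    neg-neg-square = solve-∀ ℚ-ring

  neg-^-odd : ∀ k x → (- x) ^ℚ suc (2 ℕ.* k) ≡ - (x ^ℚ suc (2 ℕ.* k))
  neg-^-odd k x = trans (cong (- x *_) (neg-^-even k x)) (sym (ℚP.neg-distribˡ-* x (x ^ℚ (2 ℕ.* k))))

module Moments where

  open import Data.Nat as ℕ using (ℕ)
  open import Data.Nat.ListAction using (sum)
  open import Data.Rational using (ℚ; 1ℚ; _+_; _*_; -_)
  open import Data.Rational.Properties
    using (≡-setoid; +-identityˡ; +-assoc; +-0-isCommutativeMonoid; neg-distrib-+; *-zeroˡ; *-distribʳ-+)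
  open import Data.List using (List; []; _∷_; _++_; map; length)
  open import Data.List.Properties using (map-++; length-++)
  open import Data.List.Relation.Binary.Permutation.Propositional using (_↭_; ↭⇒↭ₛ)
  open import Data.List.Relation.Binary.Permutation.Setoid.Properties ≡-setoid using (foldr-commMonoid)
  open import Data.Product using (_×_; _,_)
  open import Relation.Binary.PropositionalEquality
  open import Defs using (sumℚ; ℕ→ℚ; _^ℚ_; chebMoment)
  open Rationals using (ℕ→ℚ-homo-+)

  sumℚ-++ : ∀ xs ys → sumℚ (xs ++ ys) ≡ sumℚ xs + sumℚ ys
  sumℚ-++ [] ys = sym (+-identityˡ (sumℚ ys))
  sumℚ-++ (x ∷ xs) ys = trans (cong (x +_) (sumℚ-++ xs ys)) (sym (+-assoc x (sumℚ xs) (sumℚ ys)))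

  sumℚ-↭ : ∀ {xs ys} → xs ↭ ys → sumℚ xs ≡ sumℚ ys
  sumℚ-↭ xs↭ys = foldr-commMonoid +-0-isCommutativeMonoid (↭⇒↭ₛ xs↭ys)

  sumℚ-map-neg-even : ∀ (f : ℚ → ℚ) → (∀ x → f (- x) ≡ f x) →
                      ∀ xs → sumℚ (map f (map -_ xs)) ≡ sumℚ (map f xs)
  sumℚ-map-neg-even f even [] = refl
  sumℚ-map-neg-even f even (x ∷ xs) = cong₂ _+_ (even x) (sumℚ-map-neg-even f even xs)

  sumℚ-map-neg-odd : ∀ (f : ℚ → ℚ) → (∀ x → f (- x) ≡ - f x) →
                     ∀ xs → sumℚ (map f (map -_ xs)) ≡ - sumℚ (map f xs)
  sumℚ-map-neg-odd f odd [] = refl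
  sumℚ-map-neg-odd f odd (x ∷ xs) =
    trans (cong₂ _+_ (odd x) (sumℚ-map-neg-odd f odd xs)) (sym (neg-distrib-+ (f x) (sumℚ (map f xs))))

  sumℚ-*ʳ : ∀ c xs → sumℚ xs * c ≡ sumℚ (map (_* c) xs)
  sumℚ-*ʳ c [] = *-zeroˡ c
  sumℚ-*ʳ c (x ∷ xs) = trans (*-distribʳ-+ c x (sumℚ xs)) (cong (x * c +_) (sumℚ-*ʳ c xs))

  sumℚ-ℕ→ℚ : ∀ ns → sumℚ (map ℕ→ℚ ns) ≡ ℕ→ℚ (sum ns)
  sumℚ-ℕ→ℚ [] = refl
  sumℚ-ℕ→ℚ (n ∷ ns) = trans (cong (ℕ→ℚ n +_) (sumℚ-ℕ→ℚ ns)) (sym (ℕ→ℚ-homo-+ n (sum ns)))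

  sumℚ-map-^0 : ∀ xs → sumℚ (map (_^ℚ 0) xs) ≡ ℕ→ℚ (length xs)
  sumℚ-map-^0 [] = refl
  sumℚ-map-^0 (x ∷ xs) = trans (cong (_+_ 1ℚ) (sumℚ-map-^0 xs)) (sym (ℕ→ℚ-homo-+ 1 (length xs)))

  ChebyshevEvenMoments : List ℚ → Set
  ChebyshevEvenMoments ys = (sumℚ (map (_^ℚ 2) ys) ≡ ℕ→ℚ (length ys) * chebMoment 2)
                          × (sumℚ (map (_^ℚ 4) ys) ≡ ℕ→ℚ (length ys) * chebMoment 4)

  moment-++ : ∀ (f : ℚ → ℚ) c {A B} →
              sumℚ (map f A) ≡ ℕ→ℚ (length A) * c → sumℚ (map f B) ≡ ℕ→ℚ (length B) * c →
              sumℚ (map f (A ++ B)) ≡ ℕ→ℚ (length (A ++ B)) * c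
  moment-++ f c {A} {B} mA mB = begin
    sumℚ (map f (A ++ B))                           ≡⟨ cong sumℚ (map-++ f A B) ⟩
    sumℚ (map f A ++ map f B)                       ≡⟨ sumℚ-++ (map f A) (map f B) ⟩
    sumℚ (map f A) + sumℚ (map f B)                 ≡⟨ cong₂ _+_ mA mB ⟩
    ℕ→ℚ (length A) * c + ℕ→ℚ (length B) * c         ≡⟨ *-distribʳ-+ c (ℕ→ℚ (length A)) (ℕ→ℚ (length B)) ⟨
    (ℕ→ℚ (length A) + ℕ→ℚ (length B)) * c           ≡⟨ cong (_* c) (ℕ→ℚ-homo-+ (length A) (length B)) ⟨
    ℕ→ℚ (length A ℕ.+ length B) * c                 ≡⟨ cong (λ n → ℕ→ℚ n * c) (length-++ A) ⟨
    ℕ→ℚ (length (A ++ B)) * c                       ∎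
    where open ≡-Reasoning

  moments-++ : ∀ {A B} → ChebyshevEvenMoments A → ChebyshevEvenMoments B → ChebyshevEvenMoments (A ++ B)
  moments-++ {A} {B} (a₂ , a₄) (b₂ , b₄) =
    moment-++ (_^ℚ 2) (chebMoment 2) {A} {B} a₂ b₂ , moment-++ (_^ℚ 4) (chebMoment 4) {A} {B} a₄ b₄

module WithNegatives where

  open import Data.Nat as ℕ using (ℕ)
  import Data.Nat.Properties as ℕP
  open import Data.Rational using (ℚ; 0ℚ; _+_; -_; _-_; _<_)
  open import Data.Rational.Properties using (+-inverseʳ; neg-injective; neg-antimono-<; <-asym)
  open import Data.List using (List; _++_; map; length)
  open import Data.List.Properties using (map-++; length-++; length-map)
  open import Data.List.Relation.Unary.All as All using (All)
  open import Data.List.Relation.Unary.Unique.Propositional using (Unique)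
  import Data.List.Relation.Unary.Unique.Propositional.Properties as Unique
  open import Data.List.Relation.Binary.Disjoint.Propositional using (Disjoint)
  open import Data.List.Membership.Propositional.Properties using (∈-map⁻)
  open import Data.List.Relation.Binary.Permutation.Propositional using (_↭_)
  open import Data.List.Relation.Binary.Permutation.Propositional.Properties using (map⁺)
  open import Data.Product using (_,_)
  open import Relation.Binary.PropositionalEquality
  open import Defs using (sumℚ)
  open Moments using (sumℚ-++; sumℚ-↭; sumℚ-map-neg-even; sumℚ-map-neg-odd)

  withNegatives : List ℚ → List ℚ
  withNegatives ys = ys ++ map -_ ys

  length-withNegatives : ∀ ys → length (withNegatives ys) ≡ 2 ℕ.* length ys
  length-withNegatives ys = trans (length-++ ys) (cong (length ys ℕ.+_) (trans (length-map -_ ys) (sym (ℕP.+-identityʳ _))))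

  withNegatives-unique : ∀ {ys} → Unique ys → All (0ℚ <_) ys → Unique (withNegatives ys)
  withNegatives-unique {ys} u pos = Unique.++⁺ u (Unique.map⁺ neg-injective u) opposite-signs
    where
    opposite-signs : Disjoint ys (map -_ ys)
    opposite-signs (v∈ , v∈⁻) with ∈-map⁻ -_ v∈⁻
    ... | y , y∈ , refl = <-asym (All.lookup pos v∈) (neg-antimono-< (All.lookup pos y∈))

  sum-withNegatives-even : ∀ (f : ℚ → ℚ) → (∀ x → f (- x) ≡ f x) →
                           ∀ ys → sumℚ (map f (withNegatives ys)) ≡ sumℚ (map f ys) + sumℚ (map f ys)
  sum-withNegatives-even f even ys = begin
    sumℚ (map f (ys ++ map -_ ys))                   ≡⟨ cong sumℚ (map-++ f ys (map -_ ys)) ⟩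
    sumℚ (map f ys ++ map f (map -_ ys))             ≡⟨ sumℚ-++ (map f ys) (map f (map -_ ys)) ⟩
    sumℚ (map f ys) + sumℚ (map f (map -_ ys))       ≡⟨ cong (_+_ (sumℚ (map f ys))) (sumℚ-map-neg-even f even ys) ⟩
    sumℚ (map f ys) + sumℚ (map f ys)                ∎
    where open ≡-Reasoning

  sum-withNegatives-odd : ∀ (f : ℚ → ℚ) → (∀ x → f (- x) ≡ - f x) → ∀ ys → sumℚ (map f (withNegatives ys)) ≡ 0ℚ
  sum-withNegatives-odd f odd ys = begin
    sumℚ (map f (ys ++ map -_ ys))                   ≡⟨ cong sumℚ (map-++ f ys (map -_ ys)) ⟩
    sumℚ (map f ys ++ map f (map -_ ys))             ≡⟨ sumℚ-++ (map f ys) (map f (map -_ ys)) ⟩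
    sumℚ (map f ys) + sumℚ (map f (map -_ ys))       ≡⟨ cong (_+_ (sumℚ (map f ys))) (sumℚ-map-neg-odd f odd ys) ⟩
    sumℚ (map f ys) - sumℚ (map f ys)                ≡⟨ +-inverseʳ (sumℚ (map f ys)) ⟩
    0ℚ                                               ∎
    where open ≡-Reasoning

  sum-over-antipodal-pairs : ∀ (f : ℚ → ℚ) → (∀ x → f (- x) ≡ f x) → ∀ {xs ys} → xs ↭ withNegatives ys →
                             sumℚ (map f xs) ≡ sumℚ (map f ys) + sumℚ (map f ys)
  sum-over-antipodal-pairs f even {xs} {ys} xs↭ = trans (sumℚ-↭ (map⁺ f xs↭)) (sum-withNegatives-even f even ys)

module Descent where

  open import Data.Empty using (⊥)
  open import Data.List using (List; []; _∷_; length; map)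
  open import Data.List.Membership.Propositional using (_∈_)
  open import Data.List.Properties using (length-map)
  open import Data.List.Relation.Unary.All as All using (All)
  open import Data.Nat
  open import Data.Nat.Coprimality using (coprime?; coprime-divisor)
  open import Data.Nat.Divisibility
  open import Data.Nat.DivMod using ([m+kn]%n≡m%n)
  open import Data.Nat.Induction using (<-rec)
  open import Data.Nat.ListAction using (sum)
  open import Data.Nat.Properties
  open import Algebra.Properties.CommutativeSemigroup *-commutativeSemigroup using (x∙yz≈y∙xz)
  open import Data.Nat.Tactic.RingSolver using (solve-∀)
  open import Data.Product using (∃; _×_; _,_; proj₁; proj₂)
  open import Data.Sum using (_⊎_; inj₁; inj₂)
  open import Relation.Binary.PropositionalEquality
  open import Relation.Nullary using (¬_; Dec; ¬?; contradiction)
  open import Relation.Nullary.Decidable using (from-yes; toWitness; _⊎-dec_; _×-dec_; _→-dec_)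

  data EvenOdd : ℕ → Set where
    even : ∀ r → EvenOdd (2 * r)
    odd  : ∀ r → EvenOdd (1 + 2 * r)

  evenOdd : ∀ n → EvenOdd n
  evenOdd zero = even 0
  evenOdd (suc n) with evenOdd n
  ... | even r = odd r
  ... | odd r  = subst EvenOdd (2+2r r) (even (suc r))
    where
    2+2r : ∀ r → 2 * suc r ≡ suc (1 + 2 * r)
    2+2r = solve-∀

  ∣-of-+-multiple : ∀ {d a} k l → a + k * d ≡ l * d → d ∣ a
  ∣-of-+-multiple {d} {a} k l eq =
    ∣m+n∣m⇒∣n (divides l (trans (+-comm (k * d) a) eq)) (divides k refl)

  %-of-+-multiples : ∀ {a b k l} n .{{_ : NonZero n}} → a + k * n ≡ b + l * n → a % n ≡ b % n
  %-of-+-multiples {a} {b} {k} {l} n eq =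
    trans (sym ([m+kn]%n≡m%n a k n)) (trans (cong (_% n) eq) ([m+kn]%n≡m%n b l n))

  odd≢even : ∀ a b → 1 + 2 * a ≢ 2 * b
  odd≢even a b eq with %-of-+-multiples {k = a} {l = b} 2 (trans (cong (1 +_) (*-comm a 2)) (trans eq (*-comm 2 b)))
  ... | ()

  odd-square : ∀ r → ∃ λ b → (1 + 2 * r) * (1 + 2 * r) ≡ 1 + 8 * b
  odd-square r with evenOdd r
  ... | even s = s * (1 + 2 * s) , regroup s
    where
    regroup : ∀ x → (1 + 2 * (2 * x)) * (1 + 2 * (2 * x)) ≡ 1 + 8 * (x * (1 + 2 * x))
    regroup = solve-∀
  ... | odd s = (1 + 2 * s) * (1 + s) , regroup s
    where
    regroup : ∀ x → (1 + 2 * (1 + 2 * x)) * (1 + 2 * (1 + 2 * x)) ≡ 1 + 8 * ((1 + 2 * x) * (1 + x))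
    regroup = solve-∀

  odd-fourth : ∀ r → ∃ λ c → (1 + 2 * r) * (1 + 2 * r) * ((1 + 2 * r) * (1 + 2 * r)) ≡ 1 + 16 * c
  odd-fourth r with odd-square r
  ... | b , eq = b + 4 * b * b , trans (cong (λ x → x * x) eq) (regroup b)
    where
    regroup : ∀ b → (1 + 8 * b) * (1 + 8 * b) ≡ 1 + 16 * (b + 4 * b * b)
    regroup = solve-∀

  fourth-mod-16 : ∀ r → ∃ λ c → r * r * (r * r) ≡ 16 * c ⊎ r * r * (r * r) ≡ 1 + 16 * c
  fourth-mod-16 r = helper (evenOdd r)
    where
    helper : ∀ {r} → EvenOdd r → ∃ λ c → r * r * (r * r) ≡ 16 * c ⊎ r * r * (r * r) ≡ 1 + 16 * c
    helper (even s) = s * s * (s * s) , inj₁ (regroup s)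
      where
      regroup : ∀ s → 2 * s * (2 * s) * (2 * s * (2 * s)) ≡ 16 * (s * s * (s * s))
      regroup = solve-∀
    helper (odd s) = let c , eq = odd-fourth s in c , inj₂ eq

  Σ² Σ⁴ : List ℕ → ℕ
  Σ² ps = sum (map (λ p → p * p) ps)
  Σ⁴ ps = sum (map (λ p → p * p * (p * p)) ps)

  oddCount : List ℕ → ℕ
  oddCount [] = 0
  oddCount (p ∷ ps) with evenOdd p
  ... | even _ = oddCount ps
  ... | odd _  = suc (oddCount ps)

  oddCount≤length : ∀ ps → oddCount ps ≤ length ps
  oddCount≤length [] = z≤n
  oddCount≤length (p ∷ ps) with evenOdd p
  ... | even _ = m≤n⇒m≤1+n (oddCount≤length ps)
  ... | odd _  = s≤s (oddCount≤length ps)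

  Σ²-mod-4 : ∀ ps → ∃ λ x → Σ² ps ≡ oddCount ps + 4 * x
  Σ²-mod-4 [] = 0 , refl
  Σ²-mod-4 (p ∷ ps) with evenOdd p | Σ²-mod-4 ps
  ... | even r | x , eq = r * r + x , trans (cong (2 * r * (2 * r) +_) eq) (regroup r x (oddCount ps))
    where
    regroup : ∀ r x m → 2 * r * (2 * r) + (m + 4 * x) ≡ m + 4 * (r * r + x)
    regroup = solve-∀
  ... | odd r | x , eq = let b , p² = odd-square r in 2 * b + x , trans (cong₂ _+_ p² eq) (regroup b x (oddCount ps))
    where
    regroup : ∀ b x m → 1 + 8 * b + (m + 4 * x) ≡ suc m + 4 * (2 * b + x)
    regroup = solve-∀

  Σ⁴-mod-16 : ∀ ps → ∃ λ y → Σ⁴ ps ≡ oddCount ps + 16 * y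
  Σ⁴-mod-16 [] = 0 , refl
  Σ⁴-mod-16 (p ∷ ps) with evenOdd p | Σ⁴-mod-16 ps
  ... | even r | y , eq = r * r * (r * r) + y , trans (cong (2 * r * (2 * r) * (2 * r * (2 * r)) +_) eq) (regroup r y (oddCount ps))
    where
    regroup : ∀ r y m → 2 * r * (2 * r) * (2 * r * (2 * r)) + (m + 16 * y) ≡ m + 16 * (r * r * (r * r) + y)
    regroup = solve-∀
  ... | odd r | y , eq = let c , p⁴ = odd-fourth r in c + y , trans (cong₂ _+_ p⁴ eq) (regroup c y (oddCount ps))
    where
    regroup : ∀ c y m → 1 + 16 * c + (m + 16 * y) ≡ suc m + 16 * (c + y)
    regroup = solve-∀

  -- For odd p, p⁴ + 1 − 2 p² = (p² − 1)² is divisible by 64.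
  Σ⁴-all-odd : ∀ ps → oddCount ps ≡ length ps → ∃ λ z → Σ⁴ ps + length ps ≡ 2 * Σ² ps + 64 * z
  Σ⁴-all-odd [] _ = 0 , refl
  Σ⁴-all-odd (p ∷ ps) all with evenOdd p
  ... | even _ = contradiction (subst (_≤ length ps) all (oddCount≤length ps)) (n≮n (length ps))
  ... | odd r =
    let z , eq = Σ⁴-all-odd ps (suc-injective all)
        b , p² = odd-square r
    in b * b + z , step {b = b} {Σ² ps} {Σ⁴ ps} {length ps} {z} p² eq
    where
    step : ∀ {P b s₂ s₄ n z} → P ≡ 1 + 8 * b → s₄ + n ≡ 2 * s₂ + 64 * z →
           P * P + s₄ + suc n ≡ 2 * (P + s₂) + 64 * (b * b + z)
    step {b = b} {s₂} {s₄} {n} {z} refl eq = begin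
      B * B + s₄ + suc n        ≡⟨ regroup (B * B) s₄ n ⟩
      B * B + 1 + (s₄ + n)      ≡⟨ cong (B * B + 1 +_) eq ⟩
      B * B + 1 + (2 * s₂ + 64 * z) ≡⟨ square b s₂ z ⟩
      2 * (B + s₂) + 64 * (b * b + z) ∎
      where
      open ≡-Reasoning
      B = 1 + 8 * b
      regroup : ∀ x s n → x + s + suc n ≡ x + 1 + (s + n)
      regroup = solve-∀
      square : ∀ b s z → (1 + 8 * b) * (1 + 8 * b) + 1 + (2 * s + 64 * z) ≡ 2 * (1 + 8 * b + s) + 64 * (b * b + z)
      square = solve-∀

  no-odd⇒doubles : ∀ ps → oddCount ps ≡ 0 → ∃ λ rs → ps ≡ map (2 *_) rs
  no-odd⇒doubles [] _ = [] , refl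
  no-odd⇒doubles (p ∷ ps) none with evenOdd p
  ... | even r = let rs , eq = no-odd⇒doubles ps none in r ∷ rs , cong (2 * r ∷_) eq

  Σ²-double : ∀ rs → Σ² (map (2 *_) rs) ≡ 4 * Σ² rs
  Σ²-double [] = refl
  Σ²-double (r ∷ rs) = trans (cong (2 * r * (2 * r) +_) (Σ²-double rs)) (regroup r (Σ² rs))
    where
    regroup : ∀ r s → 2 * r * (2 * r) + 4 * s ≡ 4 * (r * r + s)
    regroup = solve-∀

  Σ⁴-double : ∀ rs → Σ⁴ (map (2 *_) rs) ≡ 16 * Σ⁴ rs
  Σ⁴-double [] = refl
  Σ⁴-double (r ∷ rs) = trans (cong (2 * r * (2 * r) * (2 * r * (2 * r)) +_) (Σ⁴-double rs)) (regroup r (Σ⁴ rs))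
    where
    regroup : ∀ r s → 2 * r * (2 * r) * (2 * r * (2 * r)) + 16 * s ≡ 16 * (r * r * (r * r) + s)
    regroup = solve-∀

  -- ps / q are N nonnegative rationals y with Σ y² = N/2 and Σ y⁴ = 3N/8.
  record MomentSolution (N q : ℕ) (ps : List ℕ) : Set where
    field
      length≡ : length ps ≡ N
      squares : 2 * Σ² ps ≡ N * (q * q)
      fourths : 8 * Σ⁴ ps ≡ 3 * N * (q * q * (q * q))

  MomentSolution-halve : ∀ {N r rs} → MomentSolution N (2 * r) (map (2 *_) rs) → MomentSolution N r rs
  MomentSolution-halve {N} {r} {rs} sol = record
    { length≡ = trans (sym (length-map (2 *_) rs)) length≡
    ; squares = *-cancelˡ-≡ _ _ 4 (begin
        4 * (2 * Σ² rs)             ≡⟨ x∙yz≈y∙xz 4 2 (Σ² rs) ⟩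
        2 * (4 * Σ² rs)             ≡⟨ cong (2 *_) (Σ²-double rs) ⟨
        2 * Σ² (map (2 *_) rs)      ≡⟨ squares ⟩
        N * (2 * r * (2 * r))       ≡⟨ expand₂ N r ⟩
        4 * (N * (r * r))           ∎)
    ; fourths = *-cancelˡ-≡ _ _ 16 (begin
        16 * (8 * Σ⁴ rs)            ≡⟨ x∙yz≈y∙xz 16 8 (Σ⁴ rs) ⟩
        8 * (16 * Σ⁴ rs)            ≡⟨ cong (8 *_) (Σ⁴-double rs) ⟨
        8 * Σ⁴ (map (2 *_) rs)      ≡⟨ fourths ⟩
        3 * N * (2 * r * (2 * r) * (2 * r * (2 * r)))  ≡⟨ expand₄ N r ⟩
        16 * (3 * N * (r * r * (r * r)))  ∎)
    }
    where
    open MomentSolution sol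
    open ≡-Reasoning
    expand₂ : ∀ N r → N * (2 * r * (2 * r)) ≡ 4 * (N * (r * r))
    expand₂ = solve-∀
    expand₄ : ∀ N r → 3 * N * (2 * r * (2 * r) * (2 * r * (2 * r))) ≡ 16 * (3 * N * (r * r * (r * r)))
    expand₄ = solve-∀

  32∣-of-odd-square-equations : ∀ {N m x y b c} → 2 * (m + 4 * x) ≡ N * (1 + 8 * b) →
                                8 * (m + 16 * y) ≡ 3 * N * (1 + 16 * c) → 32 ∣ N
  32∣-of-odd-square-equations {N} {m} {x} {y} {b} {c} E₂ E₄ = subst (32 ∣_) (sym N≡n*8) (*-monoˡ-∣ 8 4∣n)
    where
    open ≡-Reasoning
    8∣N : 8 ∣ N
    8∣N = coprime-divisor (from-yes (coprime? 8 3)) (∣-of-+-multiple (6 * N * c) (m + 16 * y) (begin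
      3 * N + 6 * N * c * 8     ≡⟨ expand N c ⟩
      3 * N * (1 + 16 * c)      ≡⟨ E₄ ⟨
      8 * (m + 16 * y)          ≡⟨ *-comm 8 (m + 16 * y) ⟩
      (m + 16 * y) * 8          ∎))
      where
      expand : ∀ N c → 3 * N + 6 * N * c * 8 ≡ 3 * N * (1 + 16 * c)
      expand = solve-∀
    open _∣_ 8∣N renaming (quotient to n; equality to N≡n*8)
    4∣m : 4 ∣ m
    4∣m = ∣-of-+-multiple x (n + 8 * n * b) (*-cancelˡ-≡ (m + x * 4) _ 2 (begin
      2 * (m + x * 4)             ≡⟨ cong (λ k → 2 * (m + k)) (*-comm x 4) ⟩
      2 * (m + 4 * x)             ≡⟨ E₂ ⟩
      N * (1 + 8 * b)             ≡⟨ cong (_* (1 + 8 * b)) N≡n*8 ⟩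
      n * 8 * (1 + 8 * b)         ≡⟨ expand n b ⟩
      2 * ((n + 8 * n * b) * 4)   ∎))
      where
      expand : ∀ n b → n * 8 * (1 + 8 * b) ≡ 2 * ((n + 8 * n * b) * 4)
      expand = solve-∀
    open _∣_ 4∣m renaming (quotient to t; equality to m≡t*4)
    4∣n : 4 ∣ n
    4∣n = coprime-divisor (from-yes (coprime? 4 3)) (∣-of-+-multiple (12 * n * c) (t + 4 * y)
            (*-cancelˡ-≡ (3 * n + 12 * n * c * 4) _ 8 (begin
      8 * (3 * n + 12 * n * c * 4)   ≡⟨ expand n c ⟩
      3 * (n * 8) * (1 + 16 * c)     ≡⟨ cong (λ N → 3 * N * (1 + 16 * c)) N≡n*8 ⟨
      3 * N * (1 + 16 * c)           ≡⟨ E₄ ⟨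
      8 * (m + 16 * y)               ≡⟨ cong (λ m → 8 * (m + 16 * y)) m≡t*4 ⟩
      8 * (t * 4 + 16 * y)           ≡⟨ factor t y ⟩
      8 * ((t + 4 * y) * 4)          ∎)))
      where
      expand : ∀ n c → 8 * (3 * n + 12 * n * c * 4) ≡ 3 * (n * 8) * (1 + 16 * c)
      expand = solve-∀
      factor : ∀ t y → 8 * (t * 4 + 16 * y) ≡ 8 * ((t + 4 * y) * 4)
      factor = solve-∀

  odd-denominator⇒32∣N : ∀ {N r ps} → MomentSolution N (1 + 2 * r) ps → 32 ∣ N
  odd-denominator⇒32∣N {N} {r} {ps} sol =
    32∣-of-odd-square-equations {N} {oddCount ps} {proj₁ (Σ²-mod-4 ps)} {proj₁ (Σ⁴-mod-16 ps)}
                                {proj₁ (odd-square r)} {proj₁ (odd-fourth r)} E₂ E₄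
    where
    open MomentSolution sol
    E₂ = trans (cong (2 *_) (sym (proj₂ (Σ²-mod-4 ps)))) (trans squares (cong (N *_) (proj₂ (odd-square r))))
    E₄ = trans (cong (8 *_) (sym (proj₂ (Σ⁴-mod-16 ps)))) (trans fourths (cong (3 * N *_) (proj₂ (odd-fourth r))))

  OddCountResidue : ℕ → ℕ → Set
  OddCountResidue N m = m % 16 ≡ 0 ⊎ m % 16 ≡ (6 * N) % 16

  even-denominator-residue : ∀ {N r ps} → MomentSolution N (2 * r) ps → OddCountResidue N (oddCount ps)
  even-denominator-residue {N} {r} {ps} sol = residue (fourth-mod-16 r)
    where
    open MomentSolution sol
    open ≡-Reasoning
    m = oddCount ps
    y = proj₁ (Σ⁴-mod-16 ps)
    E : m + y * 16 ≡ 6 * N * (r * r * (r * r))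
    E = *-cancelˡ-≡ _ _ 8 (begin
      8 * (m + y * 16)   ≡⟨ cong (8 *_) (trans (cong (m +_) (*-comm y 16)) (sym (proj₂ (Σ⁴-mod-16 ps)))) ⟩
      8 * Σ⁴ ps          ≡⟨ fourths ⟩
      3 * N * (2 * r * (2 * r) * (2 * r * (2 * r)))  ≡⟨ expand N r ⟩
      8 * (6 * N * (r * r * (r * r)))  ∎)
      where
      expand : ∀ N r → 3 * N * (2 * r * (2 * r) * (2 * r * (2 * r))) ≡ 8 * (6 * N * (r * r * (r * r)))
      expand = solve-∀
    residue : (∃ λ c → r * r * (r * r) ≡ 16 * c ⊎ r * r * (r * r) ≡ 1 + 16 * c) → OddCountResidue N m
    residue (c , inj₁ r⁴≡16c) = inj₁ (%-of-+-multiples {k = y} {l = 6 * N * c} 16 (begin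
      m + y * 16              ≡⟨ E ⟩
      6 * N * (r * r * (r * r)) ≡⟨ cong (6 * N *_) r⁴≡16c ⟩
      6 * N * (16 * c)        ≡⟨ expand N c ⟩
      0 + 6 * N * c * 16      ∎))
      where
      expand : ∀ N c → 6 * N * (16 * c) ≡ 0 + 6 * N * c * 16
      expand = solve-∀
    residue (c , inj₂ r⁴≡1+16c) = inj₂ (%-of-+-multiples {k = y} {l = 6 * N * c} 16 (begin
      m + y * 16              ≡⟨ E ⟩
      6 * N * (r * r * (r * r)) ≡⟨ cong (6 * N *_) r⁴≡1+16c ⟩
      6 * N * (1 + 16 * c)    ≡⟨ expand N c ⟩
      6 * N + 6 * N * c * 16  ∎))
      where
      expand : ∀ N c → 6 * N * (1 + 16 * c) ≡ 6 * N + 6 * N * c * 16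
      expand = solve-∀

  all-odd-even-denominator-impossible : ∀ {k r ps} → MomentSolution (16 * (1 + 2 * k)) (2 * r) ps →
                                        oddCount ps ≡ length ps → ⊥
  all-odd-even-denominator-impossible {k} {r} {ps} sol all = odd≢even (k + 3 * u * R₄) (2 * u * (r * r) + 2 * z)
    (*-cancelˡ-≡ _ _ 128 (begin
      128 * (1 + 2 * (k + 3 * u * R₄))          ≡⟨ expand-fourths k r ⟩
      3 * N * (2 * r * (2 * r) * (2 * r * (2 * r))) + 8 * N  ≡⟨ cong (_+ 8 * N) fourths ⟨
      8 * Σ⁴ ps + 8 * N                         ≡⟨ *-distribˡ-+ 8 (Σ⁴ ps) N ⟨
      8 * (Σ⁴ ps + N)                           ≡⟨ cong (λ n → 8 * (Σ⁴ ps + n)) length≡ ⟨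
      8 * (Σ⁴ ps + length ps)                   ≡⟨ cong (8 *_) (proj₂ (Σ⁴-all-odd ps all)) ⟩
      8 * (2 * Σ² ps + 64 * z)                  ≡⟨ cong (λ s → 8 * (s + 64 * z)) squares ⟩
      8 * (N * (2 * r * (2 * r)) + 64 * z)      ≡⟨ expand-squares k r z ⟩
      128 * (2 * (2 * u * (r * r) + 2 * z))     ∎))
    where
    open MomentSolution sol
    open ≡-Reasoning
    N = 16 * (1 + 2 * k)
    u = 1 + 2 * k
    R₄ = r * r * (r * r)
    z = proj₁ (Σ⁴-all-odd ps all)
    expand-fourths : ∀ k r → 128 * (1 + 2 * (k + 3 * (1 + 2 * k) * (r * r * (r * r))))
                 ≡ 3 * (16 * (1 + 2 * k)) * (2 * r * (2 * r) * (2 * r * (2 * r))) + 8 * (16 * (1 + 2 * k))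
    expand-fourths = solve-∀
    expand-squares : ∀ k r z → 8 * (16 * (1 + 2 * k) * (2 * r * (2 * r)) + 64 * z)
                   ≡ 128 * (2 * (2 * (1 + 2 * k) * (r * r) + 2 * z))
    expand-squares = solve-∀

  exceptions : List ℕ
  exceptions = 1 ∷ 2 ∷ 4 ∷ 5 ∷ 7 ∷ 8 ∷ 10 ∷ 13 ∷ 16 ∷ []

  exceptions-32∤ : All (λ N → ¬ 32 ∣ N) exceptions
  exceptions-32∤ = toWitness {a? = All.all? (λ N → ¬? (32 ∣? N)) exceptions} _

  exceptions-oddCount : All (λ N → ∀ {m} → m < suc N → OddCountResidue N m → m ≡ 0 ⊎ (m ≡ 16 × N ≡ 16)) exceptions
  exceptions-oddCount = toWitness {a? = All.all? (λ N → allUpTo? (residue? N) (suc N)) exceptions} _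
    where
    residue? : ∀ N m → Dec (OddCountResidue N m → m ≡ 0 ⊎ (m ≡ 16 × N ≡ 16))
    residue? N m = (m % 16 ≟ 0 ⊎-dec m % 16 ≟ (6 * N) % 16) →-dec (m ≟ 0 ⊎-dec (m ≟ 16 ×-dec N ≟ 16))

  oddCount≤N : ∀ {N q ps} → MomentSolution N q ps → oddCount ps ≤ N
  oddCount≤N {ps = ps} sol = subst (oddCount ps ≤_) (MomentSolution.length≡ sol) (oddCount≤length ps)

  no-solution : ∀ {N} → N ∈ exceptions → ∀ q ps → 0 < q → MomentSolution N q ps → ⊥
  no-solution {N} N∈ = <-rec NoSolution step
    where
    NoSolution : ℕ → Set
    NoSolution q = ∀ ps → 0 < q → MomentSolution N q ps → ⊥
    step : ∀ q → (∀ {r} → r < q → NoSolution r) → NoSolution q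
    step q rec ps 0<q sol with evenOdd q
    ... | odd r = All.lookup exceptions-32∤ N∈ (odd-denominator⇒32∣N {r = r} sol)
    ... | even zero = n≮n 0 0<q
    ... | even r@(suc _) with All.lookup exceptions-oddCount N∈ (s≤s (oddCount≤N sol)) (even-denominator-residue {r = r} sol)
    ...   | inj₁ none = let rs , ps≡ = no-odd⇒doubles ps none in
            rec (m<m+n r {r + 0} z<s) rs z<s (MomentSolution-halve {r = r} (subst (MomentSolution N (2 * r)) ps≡ sol))
    ...   | inj₂ (all , refl) = all-odd-even-denominator-impossible {k = 0} {r} sol (trans all (sym (MomentSolution.length≡ sol)))

module AntipodalSplitting where

  open import Data.Nat as ℕ using (ℕ; suc)
  import Data.Nat.Properties as ℕP
  open import Data.Rational using (ℚ; 0ℚ; -_; _<_)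
  open import Data.Rational.Properties using (_≟_; _<?_; <-cmp; <-irrefl; neg-antimono-<; +-0-group)
  open import Data.List using (List; _∷_; map; filter; length)
  open import Data.List.Relation.Unary.All as All using (All)
  open import Data.List.Relation.Unary.Any using (here; there)
  open import Data.List.Relation.Unary.Unique.Propositional using (Unique)
  import Data.List.Relation.Unary.Unique.Propositional.Properties as Unique
  open import Data.List.Relation.Unary.AllPairs using (_∷_)
  open import Data.List.Membership.Propositional using (_∈_; _∉_)
  open import Data.List.Membership.Propositional.Properties
  open import Data.List.Membership.DecPropositional _≟_ using (_∈?_)
  open import Data.List.Membership.Propositional.Properties.WithK using (unique∧set⇒bag)
  open import Data.List.Relation.Binary.BagAndSetEquality using (∼bag⇒↭)
  open import Data.List.Relation.Binary.Permutation.Propositional using (_↭_)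
  open import Data.List.Relation.Binary.Permutation.Propositional.Properties using (↭-length)
  open import Data.Product using (∃; _×_; _,_; proj₁; proj₂)
  open import Data.Sum using (_⊎_; inj₁; inj₂)
  open import Function.Bundles using (_⇔_; mk⇔; Equivalence)
  open import Function.Base using (_∘_)
  open import Relation.Binary.Definitions using (tri<; tri≈; tri>)
  open import Relation.Nullary using (yes; no; contradiction)
  open import Data.Empty using (⊥-elim)
  open import Relation.Binary.PropositionalEquality
  open import Algebra.Properties.Group +-0-group using (⁻¹-involutive)
  open import Defs using (Antipodal)
  open Descent using (odd≢even)
  open WithNegatives using (withNegatives; length-withNegatives; withNegatives-unique)

  positives : List ℚ → List ℚ
  positives = filter (0ℚ <?_)

  symmetrization : List ℚ → List ℚ
  symmetrization xs = withNegatives (positives xs)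

  nonzero-∈-symmetrization : ∀ {xs x} → Antipodal xs → x ≢ 0ℚ → x ∈ xs ⇔ x ∈ symmetrization xs
  nonzero-∈-symmetrization {xs} {x} anti x≢0 = mk⇔ to from
    where
    to : x ∈ xs → x ∈ symmetrization xs
    to x∈ with <-cmp 0ℚ x
    ... | tri< 0<x _ _ = ∈-++⁺ˡ (∈-filter⁺ (0ℚ <?_) {xs = xs} x∈ 0<x)
    ... | tri≈ _ 0≡x _ = contradiction (sym 0≡x) x≢0
    ... | tri> _ _ x<0 = ∈-++⁺ʳ (positives xs)
      (subst (_∈ map -_ (positives xs)) (⁻¹-involutive x)
        (∈-map⁺ -_ (∈-filter⁺ (0ℚ <?_) {xs = xs} (All.lookup anti x∈) (neg-antimono-< x<0))))
    from : x ∈ symmetrization xs → x ∈ xs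
    from x∈ with ∈-++⁻ (positives xs) x∈
    ... | inj₁ x∈⁺ = proj₁ (∈-filter⁻ (0ℚ <?_) {xs = xs} x∈⁺)
    ... | inj₂ x∈⁻ with ∈-map⁻ -_ x∈⁻
    ...   | y , y∈⁺ , refl = All.lookup anti (proj₁ (∈-filter⁻ (0ℚ <?_) {xs = xs} y∈⁺))

  positives-positive : ∀ xs → All (0ℚ <_) (positives xs)
  positives-positive xs = All.tabulate (λ x∈ → proj₂ (∈-filter⁻ (0ℚ <?_) {xs = xs} x∈))

  symmetrization-sign : ∀ xs {x} → x ∈ symmetrization xs → 0ℚ < x ⊎ x < 0ℚ
  symmetrization-sign xs x∈ with ∈-++⁻ (positives xs) x∈
  ... | inj₁ x∈⁺ = inj₁ (All.lookup (positives-positive xs) x∈⁺)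
  ... | inj₂ x∈⁻ with ∈-map⁻ -_ x∈⁻
  ...   | y , y∈⁺ , refl = inj₂ (neg-antimono-< (All.lookup (positives-positive xs) y∈⁺))

  0∉symmetrization : ∀ xs → 0ℚ ∉ symmetrization xs
  0∉symmetrization xs 0∈ with symmetrization-sign xs 0∈
  ... | inj₁ 0<0 = <-irrefl refl 0<0
  ... | inj₂ 0<0 = <-irrefl refl 0<0

  symmetrization-unique : ∀ {xs} → Unique xs → Unique (symmetrization xs)
  symmetrization-unique {xs} u = withNegatives-unique (Unique.filter⁺ (0ℚ <?_) u) (positives-positive xs)

  ↭-of-∈⇔ : ∀ {xs ys : List ℚ} → Unique xs → Unique ys → (∀ {x} → x ∈ xs ⇔ x ∈ ys) → xs ↭ ys
  ↭-of-∈⇔ uxs uys xs⇔ys = ∼bag⇒↭ (unique∧set⇒bag uxs uys xs⇔ys)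

  antipodal-↭ : ∀ {xs} → Unique xs → Antipodal xs → 0ℚ ∉ xs → xs ↭ symmetrization xs
  antipodal-↭ {xs} u anti 0∉ = ↭-of-∈⇔ u (symmetrization-unique u) same-elements
    where
    same-elements : ∀ {x} → x ∈ xs ⇔ x ∈ symmetrization xs
    same-elements {x} with x ≟ 0ℚ
    ... | yes refl = mk⇔ (⊥-elim ∘ 0∉) (⊥-elim ∘ 0∉symmetrization xs)
    ... | no x≢0 = nonzero-∈-symmetrization anti x≢0

  antipodal-↭-with-0 : ∀ {xs} → Unique xs → Antipodal xs → 0ℚ ∈ xs → xs ↭ 0ℚ ∷ symmetrization xs
  antipodal-↭-with-0 {xs} u anti 0∈ = ↭-of-∈⇔ u unique same-elements
    where
    unique : Unique (0ℚ ∷ symmetrization xs)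
    unique = All.tabulate (λ v∈ 0≡v → 0∉symmetrization xs (subst (_∈ symmetrization xs) (sym 0≡v) v∈))
             ∷ symmetrization-unique u
    same-elements : ∀ {x} → x ∈ xs ⇔ x ∈ 0ℚ ∷ symmetrization xs
    same-elements {x} with x ≟ 0ℚ
    ... | yes refl = mk⇔ (λ _ → here refl) (λ _ → 0∈)
    ... | no x≢0 = mk⇔ (there ∘ Equivalence.to x⇔) (Equivalence.from x⇔ ∘ drop)
      where
      x⇔ = nonzero-∈-symmetrization anti x≢0
      drop : x ∈ 0ℚ ∷ symmetrization xs → x ∈ symmetrization xs
      drop (here x≡0) = contradiction x≡0 x≢0
      drop (there x∈) = x∈

  antipodal-halves : ∀ {xs N} → Unique xs → Antipodal xs → length xs ≡ 2 ℕ.* N →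
                     ∃ λ ys → length ys ≡ N × xs ↭ withNegatives ys
  antipodal-halves {xs} {N} u anti len with 0ℚ ∈? xs
  ... | yes 0∈ = ⊥-elim (odd≢even (length (positives xs)) N
                   (trans (cong suc (sym (length-withNegatives (positives xs)))) (trans (sym (↭-length (antipodal-↭-with-0 u anti 0∈))) len)))
  ... | no 0∉ = positives xs , half , xs↭
    where
    xs↭ = antipodal-↭ u anti 0∉
    half = ℕP.*-cancelˡ-≡ _ _ 2 (trans (sym (length-withNegatives (positives xs))) (trans (sym (↭-length xs↭)) len))

module Necessity where

  open import Data.Empty using (⊥)
  open import Data.Integer as ℤ using (ℤ; +_; -[1+_]; ∣_∣)
  import Data.Integer.Properties as ℤP
  open import Data.List using ([]; _∷_; map; length)
  open import Data.List.Membership.Propositional using (_∈_)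
  open import Data.List.Properties using (map-cong; map-∘; length-map)
  open import Data.List.Relation.Binary.Permutation.Propositional using (_↭_)
  open import Data.Nat as ℕ using (ℕ; _<_; s≤s; z≤n)
  open import Data.Nat.ListAction using (sum)
  import Data.Nat.Properties as ℕP
  open import Data.Product using (∃; ∃₂; _×_; _,_)
  open import Data.Rational as ℚ using (ℚ; 1ℚ; ½; _*_; _+_; -_; _/_)
  import Data.Rational.Properties as ℚP
  open import Function.Base using (_∘_)
  open import Relation.Binary.PropositionalEquality
  open import Tactic.RingSolver using (solve-∀)
  open import Defs
  open Rationals
  open Moments
  open WithNegatives using (withNegatives; sum-over-antipodal-pairs)
  open Descent using (Σ²; Σ⁴; MomentSolution; exceptions; no-solution)
  open AntipodalSplitting using (antipodal-halves)

  common-denominator : ∀ ys → ∃₂ λ D zs → 0 < D × map (_* ℕ→ℚ D) ys ≡ map fromℤ zs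
  common-denominator [] = 1 , [] , s≤s z≤n , refl
  common-denominator (y ∷ ys) with common-denominator ys
  ... | D , zs , 0<D , eq = d ℕ.* D , (ℚ.numerator y ℤ.* + D) ∷ map (ℤ._* + d) zs ,
                            ℕP.*-mono-< {0} {d} {0} {D} (ℕP.n≢0⇒n>0 (λ ())) 0<D ,
                            cong₂ _∷_ head tail
    where
    d = ℚ.denominatorℕ y
    head : y * ℕ→ℚ (d ℕ.* D) ≡ fromℤ (ℚ.numerator y ℤ.* + D)
    head = begin
      y * ℕ→ℚ (d ℕ.* D)                ≡⟨ cong (y *_) (ℕ→ℚ-homo-* d D) ⟩
      y * (ℕ→ℚ d * ℕ→ℚ D)              ≡⟨ ℚP.*-assoc y (ℕ→ℚ d) (ℕ→ℚ D) ⟨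
      y * ℕ→ℚ d * ℕ→ℚ D                ≡⟨ cong (_* ℕ→ℚ D) (*-denominator y) ⟩
      fromℤ (ℚ.numerator y) * ℕ→ℚ D    ≡⟨ fromℤ-homo-* (ℚ.numerator y) (+ D) ⟨
      fromℤ (ℚ.numerator y ℤ.* + D)    ∎
      where open ≡-Reasoning
    rescale : ∀ x → x * ℕ→ℚ (d ℕ.* D) ≡ x * ℕ→ℚ D * ℕ→ℚ d
    rescale x = trans (cong (x *_) (trans (ℕ→ℚ-homo-* d D) (ℚP.*-comm (ℕ→ℚ d) (ℕ→ℚ D))))
                      (sym (ℚP.*-assoc x (ℕ→ℚ D) (ℕ→ℚ d)))
    tail : map (_* ℕ→ℚ (d ℕ.* D)) ys ≡ map fromℤ (map (ℤ._* + d) zs)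
    tail = begin
      map (_* ℕ→ℚ (d ℕ.* D)) ys                   ≡⟨ map-cong rescale ys ⟩
      map ((_* ℕ→ℚ d) ∘ (_* ℕ→ℚ D)) ys            ≡⟨ map-∘ ys ⟩
      map (_* ℕ→ℚ d) (map (_* ℕ→ℚ D) ys)          ≡⟨ cong (map (_* ℕ→ℚ d)) eq ⟩
      map (_* ℕ→ℚ d) (map fromℤ zs)               ≡⟨ map-∘ zs ⟨
      map ((_* ℕ→ℚ d) ∘ fromℤ) zs                 ≡⟨ map-cong (λ z → sym (fromℤ-homo-* z (+ d))) zs ⟩
      map (fromℤ ∘ (ℤ._* + d)) zs                 ≡⟨ map-∘ zs ⟩
      map fromℤ (map (ℤ._* + d) zs)               ∎
      where open ≡-Reasoning

  fromℤ-square : ∀ z → fromℤ z * fromℤ z ≡ ℕ→ℚ (∣ z ∣ ℕ.* ∣ z ∣)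
  fromℤ-square z = trans (sym (fromℤ-homo-* z z)) (cong fromℤ (square-∣∣ z))
    where
    square-∣∣ : ∀ z → z ℤ.* z ≡ + (∣ z ∣ ℕ.* ∣ z ∣)
    square-∣∣ (+ n) = sym (ℤP.pos-* n n)
    square-∣∣ -[1+ n ] = refl

  scaled-sum : ∀ (f : ℚ → ℚ) (g : ℕ → ℕ) c C {ys zs} →
               (∀ y → f y * C ≡ f (y * c)) → (∀ z → f (fromℤ z) ≡ ℕ→ℚ (g ∣ z ∣)) →
               map (_* c) ys ≡ map fromℤ zs → sumℚ (map f ys) * C ≡ ℕ→ℚ (sum (map g (map ∣_∣ zs)))
  scaled-sum f g c C {ys} {zs} homogeneous integral eq = begin
    sumℚ (map f ys) * C                 ≡⟨ sumℚ-*ʳ C (map f ys) ⟩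
    sumℚ (map (_* C) (map f ys))        ≡⟨ cong sumℚ (map-∘ ys) ⟨
    sumℚ (map ((_* C) ∘ f) ys)          ≡⟨ cong sumℚ (map-cong homogeneous ys) ⟩
    sumℚ (map (f ∘ (_* c)) ys)          ≡⟨ cong sumℚ (map-∘ ys) ⟩
    sumℚ (map f (map (_* c) ys))        ≡⟨ cong (sumℚ ∘ map f) eq ⟩
    sumℚ (map f (map fromℤ zs))         ≡⟨ cong sumℚ (map-∘ zs) ⟨
    sumℚ (map (f ∘ fromℤ) zs)           ≡⟨ cong sumℚ (map-cong integral zs) ⟩
    sumℚ (map (ℕ→ℚ ∘ g ∘ ∣_∣) zs)       ≡⟨ cong sumℚ (trans (map-∘ zs) (cong (map ℕ→ℚ) (map-∘ zs))) ⟩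
    sumℚ (map ℕ→ℚ (map g (map ∣_∣ zs))) ≡⟨ sumℚ-ℕ→ℚ (map g (map ∣_∣ zs)) ⟩
    ℕ→ℚ (sum (map g (map ∣_∣ zs)))      ∎
    where open ≡-Reasoning

  squares-scaled : ∀ {ys q zs} → map (_* ℕ→ℚ q) ys ≡ map fromℤ zs →
                   sumℚ (map (_^ℚ 2) ys) * ℕ→ℚ (q ℕ.* q) ≡ ℕ→ℚ (Σ² (map ∣_∣ zs))
  squares-scaled {ys} {q} {zs} = scaled-sum (_^ℚ 2) (λ p → p ℕ.* p) (ℕ→ℚ q) (ℕ→ℚ (q ℕ.* q)) homogeneous integral
    where
    homogeneous : ∀ y → y ^ℚ 2 * ℕ→ℚ (q ℕ.* q) ≡ (y * ℕ→ℚ q) ^ℚ 2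
    homogeneous y = trans (cong (y ^ℚ 2 *_) (ℕ→ℚ-homo-* q q)) (lemma y (ℕ→ℚ q))
      where
      lemma : ∀ y Q → y * (y * 1ℚ) * (Q * Q) ≡ y * Q * (y * Q * 1ℚ)
      lemma = solve-∀ ℚ-ring
    integral : ∀ z → fromℤ z ^ℚ 2 ≡ ℕ→ℚ (∣ z ∣ ℕ.* ∣ z ∣)
    integral z = trans (cong (fromℤ z *_) (ℚP.*-identityʳ (fromℤ z))) (fromℤ-square z)

  fourths-scaled : ∀ {ys q zs} → map (_* ℕ→ℚ q) ys ≡ map fromℤ zs →
                   sumℚ (map (_^ℚ 4) ys) * ℕ→ℚ (q ℕ.* q ℕ.* (q ℕ.* q)) ≡ ℕ→ℚ (Σ⁴ (map ∣_∣ zs))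
  fourths-scaled {ys} {q} {zs} =
    scaled-sum (_^ℚ 4) (λ p → p ℕ.* p ℕ.* (p ℕ.* p)) (ℕ→ℚ q) (ℕ→ℚ (q ℕ.* q ℕ.* (q ℕ.* q))) homogeneous integral
    where
    Q⁴≡ : ℕ→ℚ (q ℕ.* q ℕ.* (q ℕ.* q)) ≡ ℕ→ℚ q * ℕ→ℚ q * (ℕ→ℚ q * ℕ→ℚ q)
    Q⁴≡ = trans (ℕ→ℚ-homo-* (q ℕ.* q) (q ℕ.* q)) (cong₂ _*_ (ℕ→ℚ-homo-* q q) (ℕ→ℚ-homo-* q q))
    homogeneous : ∀ y → y ^ℚ 4 * ℕ→ℚ (q ℕ.* q ℕ.* (q ℕ.* q)) ≡ (y * ℕ→ℚ q) ^ℚ 4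
    homogeneous y = trans (cong (y ^ℚ 4 *_) Q⁴≡) (lemma y (ℕ→ℚ q))
      where
      lemma : ∀ y Q → y * (y * (y * (y * 1ℚ))) * (Q * Q * (Q * Q)) ≡ y * Q * (y * Q * (y * Q * (y * Q * 1ℚ)))
      lemma = solve-∀ ℚ-ring
    integral : ∀ z → fromℤ z ^ℚ 4 ≡ ℕ→ℚ (∣ z ∣ ℕ.* ∣ z ∣ ℕ.* (∣ z ∣ ℕ.* ∣ z ∣))
    integral z = trans (lemma (fromℤ z)) (trans (cong₂ _*_ (fromℤ-square z) (fromℤ-square z))
                                                (sym (ℕ→ℚ-homo-* (∣ z ∣ ℕ.* ∣ z ∣) (∣ z ∣ ℕ.* ∣ z ∣))))
      where
      lemma : ∀ x → x * (x * (x * (x * 1ℚ))) ≡ x * x * (x * x)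
      lemma = solve-∀ ℚ-ring

  squares-integral : ∀ {ys q zs} → map (_* ℕ→ℚ q) ys ≡ map fromℤ zs →
                     sumℚ (map (_^ℚ 2) ys) ≡ ℕ→ℚ (length ys) * chebMoment 2 →
                     2 ℕ.* Σ² (map ∣_∣ zs) ≡ length ys ℕ.* (q ℕ.* q)
  squares-integral {ys} {q} {zs} eq moment = ℕ→ℚ-injective (begin
    ℕ→ℚ (2 ℕ.* Σ² (map ∣_∣ zs))            ≡⟨ ℕ→ℚ-homo-* 2 (Σ² (map ∣_∣ zs)) ⟩
    ℕ→ℚ 2 * ℕ→ℚ (Σ² (map ∣_∣ zs))          ≡⟨ cong (ℕ→ℚ 2 *_) (squares-scaled {ys} {q} {zs} eq) ⟨
    ℕ→ℚ 2 * (sumℚ (map (_^ℚ 2) ys) * Q²)   ≡⟨ cong (λ s → ℕ→ℚ 2 * (s * Q²)) moment ⟩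
    ℕ→ℚ 2 * (n * ½ * Q²)                   ≡⟨ cancel n Q² ⟩
    n * Q²                                 ≡⟨ ℕ→ℚ-homo-* (length ys) (q ℕ.* q) ⟨
    ℕ→ℚ (length ys ℕ.* (q ℕ.* q))          ∎)
    where
    open ≡-Reasoning
    n = ℕ→ℚ (length ys)
    Q² = ℕ→ℚ (q ℕ.* q)
    cancel : ∀ n Q → ℕ→ℚ 2 * (n * ½ * Q) ≡ n * Q
    cancel = solve-∀ ℚ-ring

  fourths-integral : ∀ {ys q zs} → map (_* ℕ→ℚ q) ys ≡ map fromℤ zs →
                     sumℚ (map (_^ℚ 4) ys) ≡ ℕ→ℚ (length ys) * chebMoment 4 →
                     8 ℕ.* Σ⁴ (map ∣_∣ zs) ≡ 3 ℕ.* length ys ℕ.* (q ℕ.* q ℕ.* (q ℕ.* q))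
  fourths-integral {ys} {q} {zs} eq moment = ℕ→ℚ-injective (begin
    ℕ→ℚ (8 ℕ.* Σ⁴ (map ∣_∣ zs))            ≡⟨ ℕ→ℚ-homo-* 8 (Σ⁴ (map ∣_∣ zs)) ⟩
    ℕ→ℚ 8 * ℕ→ℚ (Σ⁴ (map ∣_∣ zs))          ≡⟨ cong (ℕ→ℚ 8 *_) (fourths-scaled {ys} {q} {zs} eq) ⟨
    ℕ→ℚ 8 * (sumℚ (map (_^ℚ 4) ys) * Q⁴)   ≡⟨ cong (λ s → ℕ→ℚ 8 * (s * Q⁴)) moment ⟩
    ℕ→ℚ 8 * (n * (+ 3 / 8) * Q⁴)           ≡⟨ cancel n Q⁴ ⟩
    ℕ→ℚ 3 * n * Q⁴                         ≡⟨ cong (_* Q⁴) (ℕ→ℚ-homo-* 3 (length ys)) ⟨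
    ℕ→ℚ (3 ℕ.* length ys) * Q⁴             ≡⟨ ℕ→ℚ-homo-* (3 ℕ.* length ys) (q ℕ.* q ℕ.* (q ℕ.* q)) ⟨
    ℕ→ℚ (3 ℕ.* length ys ℕ.* (q ℕ.* q ℕ.* (q ℕ.* q))) ∎)
    where
    open ≡-Reasoning
    n = ℕ→ℚ (length ys)
    Q⁴ = ℕ→ℚ (q ℕ.* q ℕ.* (q ℕ.* q))
    cancel : ∀ n Q → ℕ→ℚ 8 * (n * (+ 3 / 8) * Q) ≡ ℕ→ℚ 3 * n * Q
    cancel = solve-∀ ℚ-ring

  integral-solution : ∀ ys → ChebyshevEvenMoments ys → ∃₂ λ q ps → 0 < q × MomentSolution (length ys) q ps
  integral-solution ys (m₂ , m₄) = solution (common-denominator ys)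
    where
    solution : (∃₂ λ q zs → 0 < q × map (_* ℕ→ℚ q) ys ≡ map fromℤ zs) →
               ∃₂ λ q ps → 0 < q × MomentSolution (length ys) q ps
    solution (q , zs , 0<q , eq) = q , map ∣_∣ zs , 0<q , record
      { length≡ = begin
          length (map ∣_∣ zs)             ≡⟨ length-map ∣_∣ zs ⟩
          length zs                       ≡⟨ length-map fromℤ zs ⟨
          length (map fromℤ zs)           ≡⟨ cong length eq ⟨
          length (map (_* ℕ→ℚ q) ys)      ≡⟨ length-map (_* ℕ→ℚ q) ys ⟩
          length ys                       ∎
      ; squares = squares-integral {ys} {q} {zs} eq m₂
      ; fourths = fourths-integral {ys} {q} {zs} eq m₄
      }
      where open ≡-Reasoning

  halve-moment : ∀ {xs ys} → xs ↭ withNegatives ys → length xs ≡ 2 ℕ.* length ys → ∀ k c →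
                 sumℚ (map (_^ℚ (2 ℕ.* k)) xs) ≡ ℕ→ℚ (length xs) * c →
                 sumℚ (map (_^ℚ (2 ℕ.* k)) ys) ≡ ℕ→ℚ (length ys) * c
  halve-moment {xs} {ys} xs↭ len k c moment = begin
    S                                  ≡⟨ half-of-double S ⟩
    ½ * (S + S)                        ≡⟨ cong (½ *_) pairs ⟨
    ½ * sumℚ (map (_^ℚ (2 ℕ.* k)) xs)  ≡⟨ cong (½ *_) moment ⟩
    ½ * (ℕ→ℚ (length xs) * c)          ≡⟨ cong (λ l → ½ * (l * c)) length≡ ⟩
    ½ * (ℕ→ℚ 2 * n * c)                ≡⟨ cancel n c ⟩
    n * c                              ∎
    where
    open ≡-Reasoning
    S = sumℚ (map (_^ℚ (2 ℕ.* k)) ys)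
    n = ℕ→ℚ (length ys)
    pairs = sum-over-antipodal-pairs (_^ℚ (2 ℕ.* k)) (neg-^-even k) {xs} {ys} xs↭
    length≡ = trans (cong ℕ→ℚ len) (ℕ→ℚ-homo-* 2 (length ys))
    half-of-double : ∀ s → s ≡ ½ * (s + s)
    half-of-double = solve-∀ ℚ-ring
    cancel : ∀ n c → ½ * (ℕ→ℚ 2 * n * c) ≡ n * c
    cancel = solve-∀ ℚ-ring

  antipodal-design-half : ∀ {N xs} → length xs ≡ 2 ℕ.* N → Antipodal xs → IsChebyshevDesign 5 xs →
                          ∃ λ ys → length ys ≡ N × ChebyshevEvenMoments ys
  antipodal-design-half {N} {xs} len anti (unique , _ , moment) =
    let ys , |ys|≡N , xs↭ = antipodal-halves {xs} {N} unique anti len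
        len′ = trans len (cong (2 ℕ.*_) (sym |ys|≡N))
    in ys , |ys|≡N ,
       halve-moment {xs} {ys} xs↭ len′ 1 (chebMoment 2) (moment 2 (s≤s (s≤s z≤n))) ,
       halve-moment {xs} {ys} xs↭ len′ 2 (chebMoment 4) (moment 4 (s≤s (s≤s (s≤s (s≤s z≤n)))))

  exceptional⇒no-design : ∀ {N xs} → N ∈ exceptions → length xs ≡ 2 ℕ.* N → Antipodal xs → IsChebyshevDesign 5 xs → ⊥
  exceptional⇒no-design {N} {xs} N∈ len anti design =
    let ys , |ys|≡N , moments = antipodal-design-half {N} {xs} len anti design
        q , ps , 0<q , sol = integral-solution ys moments
    in no-solution N∈ q ps 0<q (subst (λ n → MomentSolution n q ps) |ys|≡N sol)

module Triples where

  open import Data.Nat as ℕ using (ℕ; suc; s≤s; z≤n)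
  import Data.Nat.Properties as ℕP
  open import Data.Nat.Tactic.RingSolver as ℕSolver using ()
  open import Data.Integer using (+_)
  open import Data.Rational using (ℚ; 0ℚ; 1ℚ; ½; _+_; _*_; -_; _-_; _/_; _<_; _≤_)
  import Data.Rational.Properties as ℚP
  open import Data.List using (List; []; _∷_; map)
  open import Data.Product using (_×_; _,_; proj₁; proj₂)
  open import Data.Sum using (inj₁; inj₂)
  open import Data.Empty using (⊥; ⊥-elim)
  open import Function.Base using (_∘_)
  open import Relation.Binary.Definitions using (tri<; tri≈; tri>)
  open import Relation.Nullary.Decidable using (toWitness)
  open import Relation.Binary.PropositionalEquality
  open Rationals
  open import Tactic.RingSolver using (solve-∀)
  open import Defs using (ℕ→ℚ; sumℚ; _^ℚ_)
  open Moments using (ChebyshevEvenMoments)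

  data Band : Set where
    lower middle upper : Band

  bands : List Band
  bands = lower ∷ middle ∷ upper ∷ []

  D : ℕ → ℕ
  D μ = 3 ℕ.+ suc μ ℕ.* suc μ

  numerator : ℕ → Band → ℕ
  numerator μ lower  = 3 ℕ.* (2 ℕ.+ μ)
  numerator μ middle = 3 ℕ.* μ
  numerator μ upper  = 6

  offset : ℕ → Band → ℚ
  offset μ b = + numerator μ b / D μ

  -- With t = μ + 1 these are ½ − 3(t+1)/(t²+3), ½ + 3(t−1)/(t²+3) and 1 − 6/(t²+3).
  point : ℕ → Band → ℚ
  point μ lower  = ½ - offset μ lower
  point μ middle = ½ + offset μ middle
  point μ upper  = 1ℚ - offset μ upper

  offset-pos : ∀ {μ} → 1 ℕ.≤ μ → ∀ b → 0ℚ < offset μ b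
  offset-pos {μ} _ lower = 0<a/n (numerator μ lower) (2 ℕ.+ suc μ ℕ.* suc μ) (s≤s z≤n)
  offset-pos {suc μ} _ middle = 0<a/n (numerator (suc μ) middle) (2 ℕ.+ suc (suc μ) ℕ.* suc (suc μ)) (s≤s z≤n)
  offset-pos {μ} _ upper = 0<a/n (numerator μ upper) (2 ℕ.+ suc μ ℕ.* suc μ) (s≤s z≤n)

  -- After cross-multiplication each difference is (ν − μ) times a polynomial in a = μ − 2 and
  -- o = ν − μ − 1 with nonnegative coefficients.
  offset-decreasing-step : ∀ a o b → offset (suc (2 ℕ.+ a ℕ.+ o)) b < offset (2 ℕ.+ a) b
  offset-decreasing-step a o b = a/m<b/n (numerator ν b) (2 ℕ.+ suc ν ℕ.* suc ν) (numerator μ b) (2 ℕ.+ suc μ ℕ.* suc μ)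
    (subst (numerator ν b ℕ.* D μ ℕ.<_) (sym (surplus b)) (ℕP.m<m+n _ (excess-pos b)))
    where
    μ = 2 ℕ.+ a
    ν = suc (μ ℕ.+ o)
    excess : Band → ℕ
    excess lower  = 3 ℕ.* (1 ℕ.+ o) ℕ.* (suc μ ℕ.* suc ν ℕ.+ 2 ℕ.* μ ℕ.+ o)
    excess middle = 3 ℕ.* (1 ℕ.+ o) ℕ.* (2 ℕ.+ 5 ℕ.* a ℕ.+ a ℕ.* a ℕ.+ 2 ℕ.* o ℕ.+ a ℕ.* o)
    excess upper  = 6 ℕ.* (1 ℕ.+ o) ℕ.* (suc ν ℕ.+ suc μ)
    excess-pos : ∀ b → 0 ℕ.< excess b
    excess-pos lower  = s≤s z≤n
    excess-pos middle = s≤s z≤n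
    excess-pos upper  = s≤s z≤n
    surplus : ∀ b → numerator μ b ℕ.* D ν ≡ numerator ν b ℕ.* D μ ℕ.+ excess b
    surplus lower = lemma a o
      where
      lemma : ∀ a o → 3 ℕ.* (2 ℕ.+ (2 ℕ.+ a)) ℕ.* (3 ℕ.+ suc (suc (2 ℕ.+ a ℕ.+ o)) ℕ.* suc (suc (2 ℕ.+ a ℕ.+ o)))
              ≡ 3 ℕ.* (2 ℕ.+ suc (2 ℕ.+ a ℕ.+ o)) ℕ.* (3 ℕ.+ suc (2 ℕ.+ a) ℕ.* suc (2 ℕ.+ a))
                ℕ.+ 3 ℕ.* (1 ℕ.+ o) ℕ.* (suc (2 ℕ.+ a) ℕ.* suc (suc (2 ℕ.+ a ℕ.+ o)) ℕ.+ 2 ℕ.* (2 ℕ.+ a) ℕ.+ o)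
      lemma = ℕSolver.solve-∀
    surplus middle = lemma a o
      where
      lemma : ∀ a o → 3 ℕ.* (2 ℕ.+ a) ℕ.* (3 ℕ.+ suc (suc (2 ℕ.+ a ℕ.+ o)) ℕ.* suc (suc (2 ℕ.+ a ℕ.+ o)))
              ≡ 3 ℕ.* suc (2 ℕ.+ a ℕ.+ o) ℕ.* (3 ℕ.+ suc (2 ℕ.+ a) ℕ.* suc (2 ℕ.+ a))
                ℕ.+ 3 ℕ.* (1 ℕ.+ o) ℕ.* (2 ℕ.+ 5 ℕ.* a ℕ.+ a ℕ.* a ℕ.+ 2 ℕ.* o ℕ.+ a ℕ.* o)
      lemma = ℕSolver.solve-∀
    surplus upper = lemma a o
      where
      lemma : ∀ a o → 6 ℕ.* (3 ℕ.+ suc (suc (2 ℕ.+ a ℕ.+ o)) ℕ.* suc (suc (2 ℕ.+ a ℕ.+ o)))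
              ≡ 6 ℕ.* (3 ℕ.+ suc (2 ℕ.+ a) ℕ.* suc (2 ℕ.+ a))
                ℕ.+ 6 ℕ.* (1 ℕ.+ o) ℕ.* (suc (suc (2 ℕ.+ a ℕ.+ o)) ℕ.+ suc (2 ℕ.+ a))
      lemma = ℕSolver.solve-∀

  offset-decreasing : ∀ b {μ ν} → 2 ℕ.≤ μ → μ ℕ.< ν → offset ν b < offset μ b
  offset-decreasing b {suc (suc a)} (s≤s (s≤s _)) μ<ν with ℕP.m≤n⇒∃[o]m+o≡n μ<ν
  ... | o , refl = offset-decreasing-step a o b

  offset-antitone : ∀ b {μ ν} → 2 ℕ.≤ μ → μ ℕ.≤ ν → offset ν b ≤ offset μ b
  offset-antitone b 2≤μ μ≤ν with ℕP.m≤n⇒m<n∨m≡n μ≤ν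
  ... | inj₁ μ<ν = ℚP.<⇒≤ (offset-decreasing b 2≤μ μ<ν)
  ... | inj₂ refl = ℚP.≤-refl

  point-strict : ∀ b {μ ν} → 2 ℕ.≤ μ → μ ℕ.< ν → point μ b ≢ point ν b
  point-strict lower 2≤μ μ<ν = ℚP.<⇒≢ (ℚP.+-monoʳ-< ½ (ℚP.neg-antimono-< (offset-decreasing lower 2≤μ μ<ν)))
  point-strict middle 2≤μ μ<ν = ℚP.<⇒≢ (ℚP.+-monoʳ-< ½ (offset-decreasing middle 2≤μ μ<ν)) ∘ sym
  point-strict upper 2≤μ μ<ν = ℚP.<⇒≢ (ℚP.+-monoʳ-< 1ℚ (ℚP.neg-antimono-< (offset-decreasing upper 2≤μ μ<ν)))

  point-injective : ∀ b {μ ν} → 2 ℕ.≤ μ → 2 ℕ.≤ ν → point μ b ≡ point ν b → μ ≡ ν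
  point-injective b {μ} {ν} 2≤μ 2≤ν eq with ℕP.<-cmp μ ν
  ... | tri< μ<ν _ _ = ⊥-elim (point-strict b 2≤μ μ<ν eq)
  ... | tri≈ _ μ≡ν _ = μ≡ν
  ... | tri> _ _ ν<μ = ⊥-elim (point-strict b 2≤ν ν<μ (sym eq))

  -- The points with μ ≥ 99 stay in these three narrow bands, which the sporadic sets avoid.
  InBand : Band → ℚ → Set
  InBand lower x  = point 99 lower ≤ x × x < ½
  InBand middle x = ½ < x × x ≤ point 99 middle
  InBand upper x  = point 99 upper ≤ x × x < 1ℚ

  c-u<c : ∀ c {u} → 0ℚ < u → c - u < c
  c-u<c c 0<u = subst (c - _ <_) (ℚP.+-identityʳ c) (ℚP.+-monoʳ-< c (ℚP.neg-antimono-< 0<u))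

  c<c+u : ∀ c {u} → 0ℚ < u → c < c + u
  c<c+u c 0<u = subst (_< c + _) (ℚP.+-identityʳ c) (ℚP.+-monoʳ-< c 0<u)

  point-in-band : ∀ i b → InBand b (point (99 ℕ.+ i) b)
  point-in-band i = in-band
    where
    2≤99 = ℕP.m≤m+n 2 97
    99≤μ = ℕP.m≤m+n 99 i
    1≤μ = ℕP.m≤m+n 1 (98 ℕ.+ i)
    in-band : ∀ b → InBand b (point (99 ℕ.+ i) b)
    in-band lower  = ℚP.+-monoʳ-≤ ½ (ℚP.neg-antimono-≤ (offset-antitone lower 2≤99 99≤μ)) ,
                     c-u<c ½ (offset-pos 1≤μ lower)
    in-band middle = c<c+u ½ (offset-pos 1≤μ middle) ,
                     ℚP.+-monoʳ-≤ ½ (offset-antitone middle 2≤99 99≤μ)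
    in-band upper  = ℚP.+-monoʳ-≤ 1ℚ (ℚP.neg-antimono-≤ (offset-antitone upper 2≤99 99≤μ)) ,
                     c-u<c 1ℚ (offset-pos 1≤μ upper)

  0<lowest : 0ℚ < point 99 lower
  0<lowest = toWitness {a? = 0ℚ ℚP.<? point 99 lower} _

  middle<upper : point 99 middle < point 99 upper
  middle<upper = toWitness {a? = point 99 middle ℚP.<? point 99 upper} _

  ½<1 : ½ < 1ℚ
  ½<1 = toWitness {a? = ½ ℚP.<? 1ℚ} _

  0<½ : 0ℚ < ½
  0<½ = toWitness {a? = 0ℚ ℚP.<? ½} _

  ½<middle : ½ < point 99 middle
  ½<middle = proj₁ (point-in-band 0 middle)

  in-band⇒unit : ∀ b {x} → InBand b x → 0ℚ < x × x < 1ℚ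
  in-band⇒unit lower (p≤x , x<½) = ℚP.<-≤-trans 0<lowest p≤x , ℚP.<-trans x<½ ½<1
  in-band⇒unit middle (½<x , x≤p) =
    ℚP.<-trans 0<½ ½<x , ℚP.≤-<-trans x≤p (ℚP.<-trans middle<upper (proj₂ (point-in-band 0 upper)))
  in-band⇒unit upper (p≤x , x<1) = ℚP.<-≤-trans (ℚP.<-trans 0<½ (ℚP.<-trans ½<middle middle<upper)) p≤x , x<1

  lower-middle-disjoint : ∀ {x} → InBand lower x → InBand middle x → ⊥
  lower-middle-disjoint (_ , x<½) (½<x , _) = ℚP.<-asym x<½ ½<x

  lower-upper-disjoint : ∀ {x} → InBand lower x → InBand upper x → ⊥
  lower-upper-disjoint (_ , x<½) (p≤x , _) =
    ℚP.<-irrefl refl (ℚP.<-≤-trans (ℚP.<-trans x<½ (ℚP.<-trans ½<middle middle<upper)) p≤x)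

  middle-upper-disjoint : ∀ {x} → InBand middle x → InBand upper x → ⊥
  middle-upper-disjoint (_ , x≤p) (p′≤x , _) = ℚP.<-irrefl refl (ℚP.≤-<-trans x≤p (ℚP.<-≤-trans middle<upper p′≤x))

  bands-disjoint : ∀ b b′ {x} → InBand b x → InBand b′ x → b ≡ b′
  bands-disjoint lower  lower  _ _ = refl
  bands-disjoint middle middle _ _ = refl
  bands-disjoint upper  upper  _ _ = refl
  bands-disjoint lower  middle l m = ⊥-elim (lower-middle-disjoint l m)
  bands-disjoint middle lower  m l = ⊥-elim (lower-middle-disjoint l m)
  bands-disjoint lower  upper  l u = ⊥-elim (lower-upper-disjoint l u)
  bands-disjoint upper  lower  u l = ⊥-elim (lower-upper-disjoint l u)
  bands-disjoint middle upper  m u = ⊥-elim (middle-upper-disjoint m u)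
  bands-disjoint upper  middle u m = ⊥-elim (middle-upper-disjoint m u)

  point-injective₂ : ∀ {i j b b′} → point (99 ℕ.+ i) b ≡ point (99 ℕ.+ j) b′ → i ≡ j × b ≡ b′
  point-injective₂ {i} {j} {b} {b′} eq
    with bands-disjoint b b′ (point-in-band i b) (subst (InBand b′) (sym eq) (point-in-band j b′))
  ... | refl = ℕP.+-cancelˡ-≡ 99 i j (point-injective b (ℕP.m≤m+n 2 (97 ℕ.+ i)) (ℕP.m≤m+n 2 (97 ℕ.+ j)) eq) , refl

  triple : ℕ → List ℚ
  triple μ = map (point μ) bands

  -- E stands for w (3 + (1 + m)²), which is 1 when w = 1/D μ; keeping it symbolic makes the
  -- square and fourth-power identities polynomial.
  homogeneous-triple : ℚ → ℚ → ℚ → List ℚ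
  homogeneous-triple E m w = ½ * E - ℕ→ℚ 3 * (ℕ→ℚ 2 + m) * w ∷ ½ * E + ℕ→ℚ 3 * m * w ∷ E - ℕ→ℚ 6 * w ∷ []

  triple-squares : ∀ m w →
    let E = w * (ℕ→ℚ 3 + (1ℚ + m) * (1ℚ + m))
        a = ½ * E - ℕ→ℚ 3 * (ℕ→ℚ 2 + m) * w
        b = ½ * E + ℕ→ℚ 3 * m * w
        c = E - ℕ→ℚ 6 * w
    in a * (a * 1ℚ) + (b * (b * 1ℚ) + (c * (c * 1ℚ) + 0ℚ)) ≡ ℕ→ℚ 3 * ½ * E * E
  triple-squares = solve-∀ ℚ-ring

  triple-fourths : ∀ m w →
    let E = w * (ℕ→ℚ 3 + (1ℚ + m) * (1ℚ + m))
        a = ½ * E - ℕ→ℚ 3 * (ℕ→ℚ 2 + m) * w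
        b = ½ * E + ℕ→ℚ 3 * m * w
        c = E - ℕ→ℚ 6 * w
    in a * (a * (a * (a * 1ℚ))) + (b * (b * (b * (b * 1ℚ))) + (c * (c * (c * (c * 1ℚ))) + 0ℚ))
       ≡ ℕ→ℚ 3 * (+ 3 / 8) * E * E * (E * E)
  triple-fourths = solve-∀ ℚ-ring

  reciprocal : ℕ → ℚ
  reciprocal μ = + 1 / D μ

  offset≡ : ∀ μ b → offset μ b ≡ ℕ→ℚ (numerator μ b) * reciprocal μ
  offset≡ μ b = a/n≡a*1/n (numerator μ b) (2 ℕ.+ suc μ ℕ.* suc μ)

  reciprocal-inverse : ∀ μ → reciprocal μ * (ℕ→ℚ 3 + (1ℚ + ℕ→ℚ μ) * (1ℚ + ℕ→ℚ μ)) ≡ 1ℚ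
  reciprocal-inverse μ = trans (cong (reciprocal μ *_) (sym D≡)) (1/n*n≡1 (2 ℕ.+ suc μ ℕ.* suc μ))
    where
    D≡ : ℕ→ℚ (D μ) ≡ ℕ→ℚ 3 + (1ℚ + ℕ→ℚ μ) * (1ℚ + ℕ→ℚ μ)
    D≡ = trans (ℕ→ℚ-homo-+ 3 (suc μ ℕ.* suc μ))
               (cong (_+_ (ℕ→ℚ 3)) (trans (ℕ→ℚ-homo-* (suc μ) (suc μ)) (cong₂ _*_ (ℕ→ℚ-homo-+ 1 μ) (ℕ→ℚ-homo-+ 1 μ))))

  triple≡ : ∀ μ → triple μ ≡ homogeneous-triple 1ℚ (ℕ→ℚ μ) (reciprocal μ)
  triple≡ μ = cong₃ (λ x y z → ½ - x ∷ ½ + y ∷ 1ℚ - z ∷ [])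
    (trans (offset≡ μ lower)
           (cong (_* reciprocal μ) (trans (ℕ→ℚ-homo-* 3 (2 ℕ.+ μ)) (cong (ℕ→ℚ 3 *_) (ℕ→ℚ-homo-+ 2 μ)))))
    (trans (offset≡ μ middle) (cong (_* reciprocal μ) (ℕ→ℚ-homo-* 3 μ)))
    (offset≡ μ upper)
    where
    cong₃ : ∀ {A : Set} (f : ℚ → ℚ → ℚ → A) {x x′ y y′ z z′} →
            x ≡ x′ → y ≡ y′ → z ≡ z′ → f x y z ≡ f x′ y′ z′
    cong₃ f refl refl refl = refl

  homogeneous-triple-moments : ∀ m w → w * (ℕ→ℚ 3 + (1ℚ + m) * (1ℚ + m)) ≡ 1ℚ →
                               ChebyshevEvenMoments (homogeneous-triple 1ℚ m w)
  homogeneous-triple-moments m w E≡1 =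
    subst (λ E → sumℚ (map (_^ℚ 2) (homogeneous-triple E m w)) ≡ ℕ→ℚ 3 * ½ * E * E) E≡1 (triple-squares m w) ,
    subst (λ E → sumℚ (map (_^ℚ 4) (homogeneous-triple E m w)) ≡ ℕ→ℚ 3 * (+ 3 / 8) * E * E * (E * E)) E≡1
          (triple-fourths m w)

  triple-moments : ∀ μ → ChebyshevEvenMoments (triple μ)
  triple-moments μ = subst ChebyshevEvenMoments (sym (triple≡ μ))
    (homogeneous-triple-moments (ℕ→ℚ μ) (reciprocal μ) (reciprocal-inverse μ))

module Sufficiency where

  open import Data.Nat as ℕ using (ℕ; suc; s≤s)
  import Data.Nat.Tactic.RingSolver as ℕSolver
  import Data.Nat.Properties as ℕP
  open import Data.Integer using (+_)
  open import Data.Rational using (ℚ; 0ℚ; 1ℚ; ½; _+_; _*_; -_; _/_; _<_)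
  import Data.Rational.Properties as ℚP
  open import Data.Rational.Properties using (_≤?_; _<?_; _≟_)
  open import Data.List using (List; []; _∷_; _++_; map; length; upTo; cartesianProductWith)
  open import Data.List.Properties using (length-++; length-upTo)
  open import Data.List.Relation.Unary.All as All using (All; []; _∷_)
  import Data.List.Relation.Unary.All.Properties as All
  open import Data.List.Relation.Unary.AllPairs using ([]; _∷_)
  open import Data.List.Relation.Unary.Unique.Propositional using (Unique)
  import Data.List.Relation.Unary.Unique.Propositional.Properties as Unique
  open import Data.List.Relation.Binary.Disjoint.Propositional using (Disjoint)
  open import Data.List.Membership.Propositional using (_∈_)
  open import Data.List.Membership.Propositional.Properties
    using (∈-map⁺; ∈-++⁺ˡ; ∈-++⁺ʳ; ∈-cartesianProductWith⁻)
  open import Data.Product using (∃; _×_; _,_; proj₁)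
  open import Data.Sum using (_⊎_; inj₁; inj₂)
  open import Relation.Binary.PropositionalEquality
  open import Function.Base using (_∘_)
  open import Relation.Nullary using (¬_; Dec; ¬?)
  open import Relation.Nullary.Decidable using (toWitness; _×-dec_; _⊎-dec_)
  open import Data.List.Relation.Unary.Unique.DecPropositional _≟_ using (unique?)
  open import Algebra.Properties.Group ℚP.+-0-group using (⁻¹-involutive)
  open import Defs
  open Rationals
  open import Tactic.RingSolver using (solve-∀)
  open Moments
  open WithNegatives
  open Triples

  HalfDesign : List ℚ → Set
  HalfDesign hs = Unique hs × All (λ x → 0ℚ < x × x < 1ℚ) hs × ChebyshevEvenMoments hs

  HalfDesign-++ : ∀ {A B} → HalfDesign A → HalfDesign B → Disjoint A B → HalfDesign (A ++ B)
  HalfDesign-++ {A} {B} (uA , rA , mA) (uB , rB , mB) A∩B = Unique.++⁺ uA uB A∩B , All.++⁺ rA rB , moments-++ {A} {B} mA mB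

  withNegatives-antipodal : ∀ hs → Antipodal (withNegatives hs)
  withNegatives-antipodal hs =
    All.++⁺ (All.tabulate (λ x∈ → ∈-++⁺ʳ hs (∈-map⁺ -_ x∈)))
            (All.map⁺ (All.tabulate (λ {y} y∈ → ∈-++⁺ˡ (subst (_∈ hs) (sym (⁻¹-involutive y)) y∈))))

  withNegatives-range : ∀ {hs} → All (λ x → 0ℚ < x × x < 1ℚ) hs → All (λ x → - 1ℚ < x × x < 1ℚ) (withNegatives hs)
  withNegatives-range range =
    All.++⁺ (All.map (λ (0<x , x<1) → ℚP.<-trans -1<0 0<x , x<1) range)
            (All.map⁺ (All.map (λ (0<x , x<1) → ℚP.neg-antimono-< x<1 , ℚP.<-trans (ℚP.neg-antimono-< 0<x) 0<1) range))
    where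
    0<1 = ℚP.<-trans 0<½ ½<1
    -1<0 = ℚP.neg-antimono-< 0<1

  withNegatives-moments : ∀ {hs} → ChebyshevEvenMoments hs →
                          ∀ j → j ℕ.≤ 5 → sumℚ (map (_^ℚ j) (withNegatives hs)) ≡ ℕ→ℚ (length (withNegatives hs)) * chebMoment j
  withNegatives-moments {hs} (m₂ , m₄) = moments
    where
    h = length hs
    n = ℕ→ℚ (length (withNegatives hs))
    even-moment : ∀ k c → sumℚ (map (_^ℚ (2 ℕ.* k)) hs) ≡ ℕ→ℚ h * c → sumℚ (map (_^ℚ (2 ℕ.* k)) (withNegatives hs)) ≡ n * c
    even-moment k c m = begin
      sumℚ (map (_^ℚ (2 ℕ.* k)) (withNegatives hs))   ≡⟨ sum-withNegatives-even (_^ℚ (2 ℕ.* k)) (neg-^-even k) hs ⟩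
      S + S                                           ≡⟨ cong₂ _+_ m m ⟩
      ℕ→ℚ h * c + ℕ→ℚ h * c                           ≡⟨ double (ℕ→ℚ h) c ⟩
      ℕ→ℚ 2 * ℕ→ℚ h * c                               ≡⟨ cong (_* c) (trans (cong ℕ→ℚ (length-withNegatives hs)) (ℕ→ℚ-homo-* 2 h)) ⟨
      n * c                                           ∎
      where
      open ≡-Reasoning
      S = sumℚ (map (_^ℚ (2 ℕ.* k)) hs)
      double : ∀ a c → a * c + a * c ≡ ℕ→ℚ 2 * a * c
      double = solve-∀ ℚ-ring
    odd-moment : ∀ k → sumℚ (map (_^ℚ suc (2 ℕ.* k)) (withNegatives hs)) ≡ n * 0ℚ
    odd-moment k = trans (sum-withNegatives-odd (_^ℚ suc (2 ℕ.* k)) (neg-^-odd k) hs) (sym (ℚP.*-zeroʳ n))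
    moments : ∀ j → j ℕ.≤ 5 → sumℚ (map (_^ℚ j) (withNegatives hs)) ≡ n * chebMoment j
    moments 0 _ = trans (sumℚ-map-^0 (withNegatives hs)) (sym (ℚP.*-identityʳ n))
    moments 1 _ = odd-moment 0
    moments 2 _ = even-moment 1 (chebMoment 2) m₂
    moments 3 _ = odd-moment 1
    moments 4 _ = even-moment 2 (chebMoment 4) m₄
    moments 5 _ = odd-moment 2
    moments (suc (suc (suc (suc (suc (suc _)))))) (s≤s (s≤s (s≤s (s≤s (s≤s ())))))

  antipodal-completion : ∀ {hs} → HalfDesign hs →
    length (withNegatives hs) ≡ 2 ℕ.* length hs × Antipodal (withNegatives hs) × IsChebyshevDesign 5 (withNegatives hs)
  antipodal-completion {hs} (unique , range , moments) =
    length-withNegatives hs , withNegatives-antipodal hs ,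
    withNegatives-unique unique (All.map proj₁ range) , withNegatives-range {hs} range , withNegatives-moments {hs} moments

  grid : List ℕ → List ℚ
  grid is = cartesianProductWith (λ i → point (99 ℕ.+ i)) is bands

  family : ℕ → List ℚ
  family j = grid (upTo j)

  grid-length : ∀ is → length (grid is) ≡ 3 ℕ.* length is
  grid-length [] = refl
  grid-length (i ∷ is) =
    trans (length-++ (triple (99 ℕ.+ i)) {grid is}) (trans (cong (3 ℕ.+_) (grid-length is)) (sym (ℕP.*-suc 3 (length is))))

  family-length : ∀ j → length (family j) ≡ 3 ℕ.* j
  family-length j = trans (grid-length (upTo j)) (cong (3 ℕ.*_) (length-upTo j))

  grid-moments : ∀ is → ChebyshevEvenMoments (grid is)
  grid-moments [] = refl , refl
  grid-moments (i ∷ is) = moments-++ {triple (99 ℕ.+ i)} {grid is} (triple-moments (99 ℕ.+ i)) (grid-moments is)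

  grid-∈ : ∀ {is x} → x ∈ grid is → ∃ λ i → ∃ λ b → x ≡ point (99 ℕ.+ i) b
  grid-∈ {is} x∈ with ∈-cartesianProductWith⁻ (λ i → point (99 ℕ.+ i)) is bands x∈
  ... | i , b , _ , _ , x≡ = i , b , x≡

  InSomeBand : ℚ → Set
  InSomeBand x = InBand lower x ⊎ InBand middle x ⊎ InBand upper x

  point-in-some-band : ∀ i b → InSomeBand (point (99 ℕ.+ i) b)
  point-in-some-band i lower  = inj₁ (point-in-band i lower)
  point-in-some-band i middle = inj₂ (inj₁ (point-in-band i middle))
  point-in-some-band i upper  = inj₂ (inj₂ (point-in-band i upper))

  grid-in-band : ∀ {is x} → x ∈ grid is → InSomeBand x
  grid-in-band {is} x∈ = let i , b , x≡ = grid-∈ {is} x∈ in subst InSomeBand (sym x≡) (point-in-some-band i b)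

  in-some-band⇒unit : ∀ {x} → InSomeBand x → 0ℚ < x × x < 1ℚ
  in-some-band⇒unit (inj₁ x∈) = in-band⇒unit lower x∈
  in-some-band⇒unit (inj₂ (inj₁ x∈)) = in-band⇒unit middle x∈
  in-some-band⇒unit (inj₂ (inj₂ x∈)) = in-band⇒unit upper x∈

  family-half-design : ∀ j → HalfDesign (family j)
  family-half-design j = unique , All.tabulate (in-some-band⇒unit ∘ grid-in-band {upTo j}) , grid-moments (upTo j)
    where
    unique : Unique (family j)
    unique = Unique.cartesianProductWith⁺ (λ i → point (99 ℕ.+ i)) point-injective₂ (Unique.upTo⁺ j)
               (((λ ()) ∷ (λ ()) ∷ []) ∷ ((λ ()) ∷ []) ∷ [] ∷ [])

  in-some-band? : ∀ x → Dec (InSomeBand x)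
  in-some-band? x = (point 99 lower ≤? x ×-dec x <? ½) ⊎-dec (½ <? x ×-dec x ≤? point 99 middle)
                    ⊎-dec (point 99 upper ≤? x ×-dec x <? 1ℚ)

  in-unit? : ∀ x → Dec (0ℚ < x × x < 1ℚ)
  in-unit? x = 0ℚ <? x ×-dec x <? 1ℚ

  SporadicHalfDesign : List ℚ → Set
  SporadicHalfDesign S = HalfDesign S × All (¬_ ∘ InSomeBand) S

  sporadic₁₁ : List ℚ
  sporadic₁₁ = + 16 / 105 ∷ + 1 / 6 ∷ + 2 / 5 ∷ + 44 / 105 ∷ + 19 / 35 ∷ + 23 / 30 ∷ + 88 / 105 ∷ + 13 / 15
             ∷ + 14 / 15 ∷ + 101 / 105 ∷ + 104 / 105 ∷ []

  sporadic₁₉ : List ℚ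
  sporadic₁₉ = + 29 / 570 ∷ + 23 / 285 ∷ + 11 / 95 ∷ + 17 / 95 ∷ + 4 / 19 ∷ + 4 / 15 ∷ + 3 / 5 ∷ + 64 / 95
             ∷ + 218 / 285 ∷ + 73 / 95 ∷ + 4 / 5 ∷ + 241 / 285 ∷ + 13 / 15 ∷ + 50 / 57 ∷ + 84 / 95 ∷ + 263 / 285
             ∷ + 18 / 19 ∷ + 37 / 38 ∷ + 283 / 285 ∷ []

  sporadic₁₁-valid : SporadicHalfDesign sporadic₁₁
  sporadic₁₁-valid = (toWitness {a? = unique? sporadic₁₁} _ , toWitness {a? = All.all? in-unit? sporadic₁₁} _ , refl , refl)
                      , toWitness {a? = All.all? (¬? ∘ in-some-band?) sporadic₁₁} _

  sporadic₁₉-valid : SporadicHalfDesign sporadic₁₉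
  sporadic₁₉-valid = (toWitness {a? = unique? sporadic₁₉} _ , toWitness {a? = All.all? in-unit? sporadic₁₉} _ , refl , refl)
                      , toWitness {a? = All.all? (¬? ∘ in-some-band?) sporadic₁₉} _

  sporadic-extension : ∀ {S} → SporadicHalfDesign S → ∀ j → HalfDesign (S ++ family j)
  sporadic-extension (half , gaps) j = HalfDesign-++ half (family-half-design j)
    (λ (v∈S , v∈F) → All.lookup gaps v∈S (grid-in-band {upTo j} v∈F))

  extension-length : ∀ S j → length (S ++ family j) ≡ length S ℕ.+ 3 ℕ.* j
  extension-length S j = trans (length-++ S) (cong (length S ℕ.+_) (family-length j))

  Admissible : ℕ → Set
  Admissible N = (∃ λ k → k ℕ.≥ 1 × N ≡ 3 ℕ.* k)
               ⊎ (∃ λ k → k ℕ.≥ 6 × N ≡ 3 ℕ.* k ℕ.+ 1)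
               ⊎ (∃ λ k → k ℕ.≥ 3 × N ≡ 3 ℕ.* k ℕ.+ 2)

  admissible⇒half-design : ∀ {N} → Admissible N → ∃ λ hs → length hs ≡ N × HalfDesign hs
  admissible⇒half-design (inj₁ (k , _ , refl)) = family k , family-length k , family-half-design k
  admissible⇒half-design (inj₂ (inj₁ (k , 6≤k , refl))) =
    let o , 6+o≡k = ℕP.m≤n⇒∃[o]m+o≡n 6≤k in
    sporadic₁₉ ++ family o ,
    trans (extension-length sporadic₁₉ o) (trans (count o) (cong (λ k → 3 ℕ.* k ℕ.+ 1) 6+o≡k)) ,
    sporadic-extension sporadic₁₉-valid o
    where
    count : ∀ o → 19 ℕ.+ 3 ℕ.* o ≡ 3 ℕ.* (6 ℕ.+ o) ℕ.+ 1
    count = ℕSolver.solve-∀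
  admissible⇒half-design (inj₂ (inj₂ (k , 3≤k , refl))) =
    let o , 3+o≡k = ℕP.m≤n⇒∃[o]m+o≡n 3≤k in
    sporadic₁₁ ++ family o ,
    trans (extension-length sporadic₁₁ o) (trans (count o) (cong (λ k → 3 ℕ.* k ℕ.+ 2) 3+o≡k)) ,
    sporadic-extension sporadic₁₁-valid o
    where
    count : ∀ o → 11 ℕ.+ 3 ℕ.* o ≡ 3 ℕ.* (3 ℕ.+ o) ℕ.+ 2
    count = ℕSolver.solve-∀

  admissible⇒design : ∀ {N} → Admissible N →
    ∃ λ xs → length xs ≡ 2 ℕ.* N × Antipodal xs × IsChebyshevDesign 5 xs
  admissible⇒design adm =
    let hs , len , half = admissible⇒half-design adm
        len′ , antipodal , design = antipodal-completion {hs} half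
    in withNegatives hs , trans len′ (cong (2 ℕ.*_) len) , antipodal , design

open import Defs
open import Data.Nat using (ℕ; suc; _+_; _*_; _≥_; _<_; _≤?_; s≤s)
import Data.Nat.Properties as ℕP
open import Data.Nat.DivMod using (_%_; _/_; m%n<n; m≡m%n+[m/n]*n)
open import Data.Rational using (ℚ)
open import Data.List using (List; length)
open import Data.List.Membership.Propositional using (_∈_)
open import Data.List.Membership.DecPropositional ℕP._≟_ using (_∈?_)
open import Data.Product using (Σ; ∃; _×_; _,_)
open import Data.Sum using (_⊎_; inj₁; inj₂; [_,_]′)
open import Data.Empty using (⊥-elim)
open import Function.Base using (id)
open import Function.Bundles using (_⇔_; mk⇔)
open import Relation.Nullary using (yes; no)
open import Relation.Nullary.Decidable using (toWitness)
open import Relation.Binary.PropositionalEquality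
open Descent using (exceptions)
open Necessity using (exceptional⇒no-design)
open Sufficiency using (Admissible; admissible⇒design)

1+k*3∈exceptions : ∀ {k} → k < 6 → 1 + k * 3 ∈ exceptions
1+k*3∈exceptions = toWitness {a? = ℕP.allUpTo? (λ k → (1 + k * 3) ∈? exceptions) 6} _

2+k*3∈exceptions : ∀ {k} → k < 3 → 2 + k * 3 ∈ exceptions
2+k*3∈exceptions = toWitness {a? = ℕP.allUpTo? (λ k → (2 + k * 3) ∈? exceptions) 3} _

exceptional⊎admissible : ∀ N → N ≥ 1 → N ∈ exceptions ⊎ Admissible N
exceptional⊎admissible N N≥1 = by-residue (N % 3) (m%n<n N 3) (m≡m%n+[m/n]*n N 3)
  where
  k = N / 3
  by-residue : ∀ r → r < 3 → N ≡ r + k * 3 → N ∈ exceptions ⊎ Admissible N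
  by-residue 0 _ N≡ with 1 ≤? k
  ... | yes 1≤k = inj₂ (inj₁ (k , 1≤k , trans N≡ (ℕP.*-comm k 3)))
  ... | no k≱1 = ⊥-elim (ℕP.<-irrefl (sym (trans N≡ (cong (_* 3) (ℕP.n<1⇒n≡0 (ℕP.≰⇒> k≱1))))) N≥1)
  by-residue 1 _ N≡ with 6 ≤? k
  ... | yes 6≤k = inj₂ (inj₂ (inj₁ (k , 6≤k , trans N≡ (trans (ℕP.+-comm 1 (k * 3)) (cong (_+ 1) (ℕP.*-comm k 3))))))
  ... | no k≱6 = inj₁ (subst (_∈ exceptions) (sym N≡) (1+k*3∈exceptions (ℕP.≰⇒> k≱6)))
  by-residue 2 _ N≡ with 3 ≤? k
  ... | yes 3≤k = inj₂ (inj₂ (inj₂ (k , 3≤k , trans N≡ (trans (ℕP.+-comm 2 (k * 3)) (cong (_+ 2) (ℕP.*-comm k 3))))))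
  ... | no k≱3 = inj₁ (subst (_∈ exceptions) (sym N≡) (2+k*3∈exceptions (ℕP.≰⇒> k≱3)))
  by-residue (suc (suc (suc _))) (s≤s (s≤s (s≤s ())))

theorem1p4 : (N : ℕ) → N ≥ 1 →
    (Σ (List ℚ) (λ xs → (length xs ≡ 2 * N) × Antipodal xs × IsChebyshevDesign 5 xs))
    ⇔ ((∃ λ k → k ≥ 1 × N ≡ 3 * k)
       ⊎ (∃ λ k → k ≥ 6 × N ≡ 3 * k + 1)
       ⊎ (∃ λ k → k ≥ 3 × N ≡ 3 * k + 2))
theorem1p4 N N≥1 = mk⇔ necessity admissible⇒design
  where
  necessity : (Σ (List ℚ) λ xs → length xs ≡ 2 * N × Antipodal xs × IsChebyshevDesign 5 xs) → Admissible N
  necessity (xs , len , antipodal , design) =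
    [ (λ N∈ → ⊥-elim (exceptional⇒no-design N∈ len antipodal design)) , id ]′ (exceptional⊎admissible N N≥1)
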